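{- Let $n\geq 1$ and $m\geq 0$ be integers and let $Y_{n,m}$ be the Yoke graph, with $0$ its all-zero vertex. Then: 1. If $n=1$, then $\mathrm{ecc}_{Y_{n,m}}(0)=\binom{\lceil m/2\rceil+1}{2}+\binom{\lfloor m/2\rfloor+1}{2}$. 2. If $0\leq m\leq n$, then $\mathrm{ecc}_{Y_{n,m}}(0)=\lfloor n(m+1)/2\rfloor$. 3. If $2\leq n\leq m$, let $d_0=\binom{\lfloor (m+n)/2\rfloor+1}{2}+\binom{\lceil (m-n)/2\rceil+1}{2}$. Then (a) if either $2\mid (m-n)$ or $n\leq \lceil (m+1)/2\rceil$, then $\mathrm{ecc}_{Y_{n,m}}(0)=d_0$; (b) otherwise $\mathrm{ecc}_{Y_{n,m}}(0)=d_0+n-\lceil (m+1)/2\rceil$.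
   Context: For integers $n\geq 1$, $m\geq 0$, the Yoke graph $Y_{n,m}$ is the simple graph whose vertices are the tuples $v=(v_0,v_1,\dots,v_{m+1})$ with $v_0,v_{m+1}\in\mathbb{Z}_n$ (the "buckets"), $v_1,\dots,v_m\in\{0,1\}$, and $\sum_{i=0}^{m+1}v_i\equiv 0 \pmod n$. Two vertices $u,v$ are adjacent iff there is $0\leq i\leq m$ such that $u_j=v_j$ for all $j\notin\{i,i+1\}$ and either ($u_i=v_i+1$ and $u_{i+1}=v_{i+1}-1$) or ($u_i=v_i-1$ and $u_{i+1}=v_{i+1}+1$), where arithmetic in the bucket coordinates $0$ and $m+1$ is in $\mathbb{Z}_n$ (and all entries must stay in their allowed sets). The vertex $(0,\dots,0)$ is denoted $0$. $\mathrm{ecc}_G(x)$ denotes the maximum graph distance from $x$ to any vertex of $G$. -}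

module Defs where

open import Data.Nat using (ℕ; zero; suc; _+_; _*_; _∸_; _≤_; _<_; ⌊_/2⌋; ⌈_/2⌉)
open import Data.Nat.Divisibility using (_∣_)
open import Data.Nat.Combinatorics using (_C_)
open import Data.Fin using (Fin; toℕ; inject₁) renaming (suc to fsuc)
open import Data.Vec using (Vec; lookup; replicate; sum)
open import Data.Product using (Σ; _×_; _,_)
open import Data.Sum using (_⊎_)
open import Relation.Nullary using (¬_)
open import Relation.Binary.PropositionalEquality using (_≡_; _≢_)

-- A vertex candidate of Y_{n,m}: the tuple (v_0, v_1, ..., v_{m+1}) as a vector
-- of naturals of length m+2. Position 0 and position m+1 are the buckets.
Coord : ℕ → Set
Coord m = Vec ℕ (suc (suc m))

IsBucket : (m : ℕ) → Fin (suc (suc m)) → Set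
IsBucket m j = (toℕ j ≡ 0) ⊎ (toℕ j ≡ suc m)

Valid : ℕ → (m : ℕ) → Coord m → Set
Valid n m v =
  (∀ j → IsBucket m j → lookup v j < n) ×
  (∀ j → ¬ IsBucket m j → lookup v j ≤ 1) ×
  (n ∣ sum v)

-- Succ n m j x y : in coordinate j, y = x + 1 (computed in Z_n for buckets,
-- in ℕ for interior coordinates).
Succ : ℕ → (m : ℕ) → Fin (suc (suc m)) → ℕ → ℕ → Set
Succ n m j x y =
  (IsBucket m j × ((suc x < n × y ≡ suc x) ⊎ (suc x ≡ n × y ≡ 0))) ⊎
  (¬ IsBucket m j × y ≡ suc x)

Adj : ℕ → (m : ℕ) → Coord m → Coord m → Set
Adj n m u v = Σ (Fin (suc m)) λ i →
  (∀ j → toℕ j ≢ toℕ i → toℕ j ≢ suc (toℕ i) → lookup u j ≡ lookup v j) ×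
  ( (Succ n m (inject₁ i) (lookup v (inject₁ i)) (lookup u (inject₁ i)) ×
     Succ n m (fsuc i) (lookup u (fsuc i)) (lookup v (fsuc i)))
  ⊎ (Succ n m (inject₁ i) (lookup u (inject₁ i)) (lookup v (inject₁ i)) ×
     Succ n m (fsuc i) (lookup v (fsuc i)) (lookup u (fsuc i))))

-- Walks of length k in Y_{n,m} (every vertex after the first is required valid;
-- the first is valid whenever it is the source we use).
data Walk (n m : ℕ) : Coord m → Coord m → ℕ → Set where
  here : ∀ {x} → Walk n m x x 0
  step : ∀ {x y z k} → Valid n m x → Adj n m x y → Valid n m y →
         Walk n m y z k → Walk n m x z (suc k)

IsDist : (n m : ℕ) → Coord m → Coord m → ℕ → Set
IsDist n m x y d = Walk n m x y d × (∀ k → k < d → ¬ Walk n m x y k)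

IsEcc : (n m : ℕ) → Coord m → ℕ → Set
IsEcc n m x e =
  (∀ y → Valid n m y → Σ ℕ λ d → d ≤ e × IsDist n m x y d) ×
  (Σ (Coord m) λ y → Valid n m y × IsDist n m x y e)

𝟎 : (m : ℕ) → Coord m
𝟎 m = replicate _ 0

T : ℕ → ℕ
T k = suc k C 2

d₀ : ℕ → ℕ → ℕ
d₀ n m = T ⌊ (m + n) /2⌋ + T ⌈ (m ∸ n) /2⌉

-- Encode a vertex v by its prefix sums P k = v₀ + ⋯ + v_k (k ≤ m): they form a staircase
-- (steps 0 or 1). For a level q let cost q = Σ_k ∣ P k − q n ∣. Along an edge a unit move
-- changes one prefix sum by one, and a wrap-around in a bucket shifts all of them by n, so
-- min_q cost q drops by at most one per edge; conversely from any vertex of positive cost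
-- a suitable unit move lowers it by exactly one. Hence d(0, v) = min_q cost q, and the
-- eccentricity is the largest, over staircases, of the least spread around a multiple of n.
-- Around a central level the spread is at most a sum of two triangular numbers; around two
-- consecutive multiples c and c + n the two spreads add up to (m + 1) n plus twice the
-- overshoot outside [c, c + n], so one of them is small when few points lie outside. Ramps
-- with at most one missing step, and nearly constant staircases, attain these bounds.

module Submission where

open import Defs
open import Data.Nat using (ℕ; zero; suc; _+_; _*_; _∸_; _≤_; _<_; ⌊_/2⌋; ⌈_/2⌉; z≤n; s≤s; ∣_-_∣; _≤?_; _<?_; _≟_; _%_; _/_)
open import Data.Nat.Properties
open import Data.Nat.Combinatorics using (_C_; nC1≡n; nCk+nC[k+1]≡[n+1]C[k+1])
open import Data.Nat.DivMod using (m%n<n; m≡m%n+[m/n]*n; n%n≡0; m<n⇒m%n≡m)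
open import Data.Nat.Divisibility using (_∣_; divides; ∣m+n∣m⇒∣n; ∣m∣n⇒∣m+n; m∣m*n; ∣⇒≤)
open import Data.Fin using (Fin; toℕ; inject₁; fromℕ<) renaming (zero to fzero; suc to fsuc)
open import Data.Fin.Properties using (toℕ-fromℕ<; toℕ-inject₁; toℕ<n)
open import Data.Vec using (Vec; []; _∷_; lookup; replicate; sum)
open import Data.Product using (Σ; _×_; _,_; proj₁; proj₂)
open import Data.Sum using (_⊎_; inj₁; inj₂; [_,_]; map₂)
open import Data.Empty using (⊥-elim)
open import Relation.Nullary using (¬_; Dec; yes; no)
open import Relation.Binary.PropositionalEquality using (_≡_; _≢_; refl; sym; trans; cong; cong₂; subst; subst₂; module ≡-Reasoning)
open import Data.Nat.Tactic.RingSolver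
open import Algebra.Properties.CommutativeSemigroup +-commutativeSemigroup using (interchange; xy∙z≈xz∙y; xy∙z≈y∙xz; x∙yz≈y∙xz)

-- Finite sums, triangular numbers and indicators

sumTo : (ℕ → ℕ) → ℕ → ℕ
sumTo f zero = f zero
sumTo f (suc m) = sumTo f m + f (suc m)

sumTo-cong : ∀ {f g : ℕ → ℕ} m → (∀ k → k ≤ m → f k ≡ g k) → sumTo f m ≡ sumTo g m
sumTo-cong zero h = h 0 z≤n
sumTo-cong (suc m) h = cong₂ _+_ (sumTo-cong m (λ k k≤m → h k (m≤n⇒m≤1+n k≤m))) (h (suc m) ≤-refl)

sumTo-mono-≤ : ∀ {f g : ℕ → ℕ} m → (∀ k → k ≤ m → f k ≤ g k) → sumTo f m ≤ sumTo g m
sumTo-mono-≤ zero h = h 0 z≤n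
sumTo-mono-≤ (suc m) h = +-mono-≤ (sumTo-mono-≤ m (λ k k≤m → h k (m≤n⇒m≤1+n k≤m))) (h (suc m) ≤-refl)

sumTo-+ : ∀ (f g : ℕ → ℕ) m → sumTo (λ k → f k + g k) m ≡ sumTo f m + sumTo g m
sumTo-+ f g zero = refl
sumTo-+ f g (suc m) rewrite sumTo-+ f g m = interchange (sumTo f m) (sumTo g m) (f (suc m)) (g (suc m))

sumTo-const : ∀ c m → sumTo (λ _ → c) m ≡ suc m * c
sumTo-const c zero = sym (+-identityʳ c)
sumTo-const c (suc m) rewrite sumTo-const c m = +-comm (c + m * c) c

sumTo-*ˡ : ∀ a (f : ℕ → ℕ) m → sumTo (λ k → a * f k) m ≡ a * sumTo f m
sumTo-*ˡ a f zero = refl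
sumTo-*ˡ a f (suc m) rewrite sumTo-*ˡ a f m = sym (*-distribˡ-+ a (sumTo f m) (f (suc m)))

sumTo-unfoldˡ : ∀ (f : ℕ → ℕ) m → sumTo f (suc m) ≡ f 0 + sumTo (λ k → f (suc k)) m
sumTo-unfoldˡ f zero = refl
sumTo-unfoldˡ f (suc m) rewrite sumTo-unfoldˡ f m = +-assoc (f 0) _ _

sumTo-monoʳ-≤ : ∀ (f : ℕ → ℕ) {i j} → i ≤ j → sumTo f i ≤ sumTo f j
sumTo-monoʳ-≤ f {i} {j} i≤j with m≤n⇒∃[o]m+o≡n i≤j
... | d , refl = go d
  where
  go : ∀ d → sumTo f i ≤ sumTo f (i + d)
  go zero rewrite +-identityʳ i = ≤-refl
  go (suc d) rewrite +-suc i d = ≤-trans (go d) (m≤m+n _ _)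

term≤sumTo : ∀ (f : ℕ → ℕ) {k} m → k ≤ m → f k ≤ sumTo f m
term≤sumTo f zero z≤n = ≤-refl
term≤sumTo f {k} (suc m) k≤ with k ≟ suc m
... | yes refl = m≤n+m _ _
... | no k≢ = ≤-trans (term≤sumTo f m (≤-pred (≤∧≢⇒< k≤ k≢))) (m≤m+n _ _)

sumTo-incr : ∀ (f g : ℕ → ℕ) i m → i ≤ m → (∀ k → k ≤ m → k ≢ i → f k ≡ g k) → f i + 1 ≡ g i →
  sumTo f m + 1 ≡ sumTo g m
sumTo-incr f g .0 zero z≤n _ e = e
sumTo-incr f g i (suc m) i≤ agree e with i ≟ suc m
... | yes refl = begin
    sumTo f m + f (suc m) + 1   ≡⟨ +-assoc (sumTo f m) _ 1 ⟩
    sumTo f m + (f (suc m) + 1) ≡⟨ cong₂ _+_ (sumTo-cong m (λ k k≤m → agree k (m≤n⇒m≤1+n k≤m) (<⇒≢ (s≤s k≤m)))) e ⟩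
    sumTo g m + g (suc m)       ∎
    where open ≡-Reasoning
... | no i≢ = begin
    sumTo f m + f (suc m) + 1   ≡⟨ +-assoc (sumTo f m) _ 1 ⟩
    sumTo f m + (f (suc m) + 1) ≡⟨ cong (sumTo f m +_) (+-comm (f (suc m)) 1) ⟩
    sumTo f m + (1 + f (suc m)) ≡⟨ sym (+-assoc (sumTo f m) 1 _) ⟩
    sumTo f m + 1 + f (suc m)   ≡⟨ cong₂ _+_ (sumTo-incr f g i m (≤-pred (≤∧≢⇒< i≤ i≢)) (λ k k≤m → agree k (m≤n⇒m≤1+n k≤m)) e)
                                             (agree (suc m) ≤-refl (λ e′ → i≢ (sym e′))) ⟩
    sumTo g m + g (suc m)       ∎
    where open ≡-Reasoning

sumTo-bits-≤ : ∀ (f : ℕ → ℕ) m → (∀ k → k ≤ m → f k ≤ 1) → sumTo f m ≤ suc m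
sumTo-bits-≤ f m bits = subst (sumTo f m ≤_) (trans (sumTo-const 1 m) (*-identityʳ (suc m))) (sumTo-mono-≤ m bits)

sumTo-zeros : ∀ (f : ℕ → ℕ) m → (∀ k → k ≤ m → f k ≡ 0) → sumTo f m ≡ 0
sumTo-zeros f m zeros = trans (sumTo-cong m zeros) (trans (sumTo-const 0 m) (*-zeroʳ (suc m)))

sumTo-bits+complement : ∀ (f : ℕ → ℕ) m → (∀ k → k ≤ m → f k ≤ 1) → sumTo f m + sumTo (λ k → 1 ∸ f k) m ≡ suc m
sumTo-bits+complement f m bits = trans (sym (sumTo-+ f (λ k → 1 ∸ f k) m))
  (trans (sumTo-cong m (λ k k≤ → m+[n∸m]≡n (bits k k≤))) (trans (sumTo-const 1 m) (*-identityʳ (suc m))))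

sumTo-bits-minority : ∀ (f : ℕ → ℕ) m → (∀ k → k ≤ m → f k ≤ 1) → 2 * sumTo f m ≤ suc m → sumTo f m ≤ sumTo (λ k → 1 ∸ f k) m
sumTo-bits-minority f m bits 2Σ≤ = +-cancelˡ-≤ (sumTo f m) _ _
  (subst (sumTo f m + sumTo f m ≤_) (sym (sumTo-bits+complement f m bits)) (subst (_≤ suc m) (cong (sumTo f m +_) (+-identityʳ _)) 2Σ≤))

sumTo-bits-vanishing-from : ∀ (f : ℕ → ℕ) m j → (∀ k → k ≤ m → f k ≤ 1) → (∀ k → j ≤ k → k ≤ m → f k ≡ 0) → sumTo f m ≤ j
sumTo-bits-vanishing-from f zero zero _ zeros = ≤-reflexive (zeros 0 z≤n z≤n)
sumTo-bits-vanishing-from f zero (suc j) bits _ = ≤-trans (bits 0 z≤n) (s≤s z≤n)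
sumTo-bits-vanishing-from f (suc m) j bits zeros with j ≤? suc m
... | yes j≤sm = subst (_≤ j) (sym (trans (cong (sumTo f m +_) (zeros (suc m) j≤sm ≤-refl)) (+-identityʳ _)))
      (sumTo-bits-vanishing-from f m j (λ k k≤ → bits k (m≤n⇒m≤1+n k≤)) (λ k j≤k k≤ → zeros k j≤k (m≤n⇒m≤1+n k≤)))
... | no j≰sm = ≤-trans (sumTo-bits-≤ f (suc m) bits) (≰⇒> j≰sm)

sumTo-bits-vanishing-upto : ∀ (f : ℕ → ℕ) m j → (∀ k → k ≤ m → f k ≤ 1) → (∀ k → k ≤ j → f k ≡ 0) → sumTo f m ≤ m ∸ j
sumTo-bits-vanishing-upto f zero j _ zeros = ≤-trans (≤-reflexive (zeros 0 z≤n)) z≤n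
sumTo-bits-vanishing-upto f (suc m) j bits zeros with suc m ≤? j
... | yes sm≤j = subst (_≤ suc m ∸ j) (sym (trans (cong (sumTo f m +_) (zeros (suc m) sm≤j)) (+-identityʳ _)))
      (≤-trans (sumTo-bits-vanishing-upto f m j (λ k k≤ → bits k (m≤n⇒m≤1+n k≤)) zeros) (∸-monoˡ-≤ j (n≤1+n m)))
... | no sm≰j = ≤-trans (+-mono-≤ (sumTo-bits-vanishing-upto f m j (λ k k≤ → bits k (m≤n⇒m≤1+n k≤)) zeros) (bits (suc m) ≤-refl))
      (≤-reflexive (trans (+-comm _ 1) (sym (+-∸-assoc 1 (≤-pred (≰⇒> sm≰j))))))

tri : ℕ → ℕ
tri zero = 0
tri (suc k) = tri k + suc k

T≡tri : ∀ k → T k ≡ tri k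
T≡tri zero = refl
T≡tri (suc k) = begin
  suc (suc k) C 2       ≡⟨ sym (nCk+nC[k+1]≡[n+1]C[k+1] (suc k) 1) ⟩
  suc k C 1 + suc k C 2 ≡⟨ cong₂ _+_ (nC1≡n (suc k)) (T≡tri k) ⟩
  suc k + tri k         ≡⟨ +-comm (suc k) (tri k) ⟩
  tri k + suc k         ∎
  where open ≡-Reasoning

tri-mono-≤ : ∀ {a b} → a ≤ b → tri a ≤ tri b
tri-mono-≤ {zero} _ = z≤n
tri-mono-≤ {suc a} {suc b} (s≤s a≤b) = +-mono-≤ (tri-mono-≤ a≤b) (s≤s a≤b)

tri-+ : ∀ a b → tri (a + b) ≡ tri a + tri b + a * b
tri-+ zero b = sym (+-identityʳ (tri b))
tri-+ (suc a) b = begin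
  tri (a + b) + suc (a + b)         ≡⟨ cong (_+ suc (a + b)) (tri-+ a b) ⟩
  tri a + tri b + a * b + suc (a + b) ≡⟨ rearrange (tri a) (tri b) a b ⟩
  tri a + suc a + tri b + suc a * b   ∎
  where
  open ≡-Reasoning
  rearrange : ∀ ta tb a b → ta + tb + a * b + suc (a + b) ≡ ta + suc a + tb + suc a * b
  rearrange = solve-∀

tri+tri : ∀ a → tri a + tri a ≡ a * suc a
tri+tri zero = refl
tri+tri (suc a) = begin
  tri a + suc a + (tri a + suc a) ≡⟨ rearrange (tri a) a ⟩
  (tri a + tri a) + 2 * suc a     ≡⟨ cong (_+ 2 * suc a) (tri+tri a) ⟩
  a * suc a + 2 * suc a           ≡⟨ expand a ⟩
  suc a * suc (suc a)             ∎
  where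
  open ≡-Reasoning
  rearrange : ∀ t a → t + suc a + (t + suc a) ≡ (t + t) + 2 * suc a
  rearrange = solve-∀
  expand : ∀ a → a * suc a + 2 * suc a ≡ suc a * suc (suc a)
  expand = solve-∀

tri-spread-≤ : ∀ a b → a ≤ b → tri (suc a) + tri b ≤ tri a + tri (suc b)
tri-spread-≤ a b a≤b = begin
  tri a + suc a + tri b   ≡⟨ +-assoc (tri a) (suc a) (tri b) ⟩
  tri a + (suc a + tri b) ≤⟨ +-monoʳ-≤ (tri a) (+-monoˡ-≤ (tri b) (s≤s a≤b)) ⟩
  tri a + (suc b + tri b) ≡⟨ cong (tri a +_) (+-comm (suc b) (tri b)) ⟩
  tri a + (tri b + suc b) ∎
  where open ≤-Reasoning

tri-spread-by-≤ : ∀ s a b → a + s ≤ b → tri (a + s) + tri b ≤ tri a + tri (s + b)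
tri-spread-by-≤ zero a b _ rewrite +-identityʳ a = ≤-refl
tri-spread-by-≤ (suc s) a b a+s<b rewrite +-suc a s = begin
  tri (suc (a + s)) + tri b ≤⟨ tri-spread-≤ (a + s) b (<⇒≤ a+s<b) ⟩
  tri (a + s) + tri (suc b) ≤⟨ tri-spread-by-≤ s a (suc b) (m≤n⇒m≤1+n (<⇒≤ a+s<b)) ⟩
  tri a + tri (s + suc b)   ≡⟨ cong (λ t → tri a + tri t) (+-suc s b) ⟩
  tri a + tri (suc (s + b)) ∎
  where open ≤-Reasoning

tri-split-≤ : ∀ m A g → A ≤ g → g ≤ m ∸ A → tri g + tri (m ∸ g) ≤ tri A + tri (m ∸ A)
tri-split-≤ m A g A≤g g≤m∸A with ≤-total g (m ∸ g)
... | inj₁ g≤m∸g = subst₂ (λ s t → tri s + tri (m ∸ g) ≤ tri A + tri t) g≡ m∸A≡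
      (tri-spread-by-≤ (g ∸ A) A (m ∸ g) (subst (_≤ m ∸ g) (sym g≡) g≤m∸g))
  where
  g≤m : g ≤ m
  g≤m = ≤-trans g≤m∸A (m∸n≤m m A)
  g≡ : A + (g ∸ A) ≡ g
  g≡ = m+[n∸m]≡n A≤g
  m∸A≡ : (g ∸ A) + (m ∸ g) ≡ m ∸ A
  m∸A≡ = trans (sym (+-∸-comm (m ∸ g) A≤g)) (cong (_∸ A) (m+[n∸m]≡n g≤m))
... | inj₂ m∸g≤g = subst (_≤ tri A + tri (m ∸ A)) (+-comm (tri (m ∸ g)) (tri g))
      (subst₂ (λ s t → tri s + tri g ≤ tri A + tri t) m∸g≡ m∸A≡
        (tri-spread-by-≤ (m ∸ g ∸ A) A g (subst (_≤ g) (sym m∸g≡) m∸g≤g)))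
  where
  g≤m : g ≤ m
  g≤m = ≤-trans g≤m∸A (m∸n≤m m A)
  A≤m∸g : A ≤ m ∸ g
  A≤m∸g = subst (_≤ m ∸ g) (m∸[m∸n]≡n (≤-trans A≤g g≤m)) (∸-monoʳ-≤ m g≤m∸A)
  m∸g≡ : A + (m ∸ g ∸ A) ≡ m ∸ g
  m∸g≡ = m+[n∸m]≡n A≤m∸g
  m∸A≡ : (m ∸ g ∸ A) + g ≡ m ∸ A
  m∸A≡ = trans (sym (+-∸-comm g A≤m∸g)) (cong (_∸ A) (m∸n+n≡m g≤m))

tri-pair-≤ : ∀ m A E → tri A + tri (m ∸ A) ≤ E →
  ∀ g d → A ≤ g → g ≤ m ∸ A → g + d ≤ m → tri g + tri d ≤ E
tri-pair-≤ m A E bound g d A≤g g≤m∸A g+d≤m =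
  ≤-trans (+-monoʳ-≤ (tri g) (tri-mono-≤ d≤m∸g)) (≤-trans (tri-split-≤ m A g A≤g g≤m∸A) bound)
  where
  d≤m∸g : d ≤ m ∸ g
  d≤m∸g = subst (_≤ m ∸ g) (m+n∸m≡n g d) (∸-monoˡ-≤ g g+d≤m)

χ< : ℕ → ℕ → ℕ
χ< a zero = 0
χ< zero (suc c) = 1
χ< (suc a) (suc c) = χ< a c

χ<-yes : ∀ {a c} → a < c → χ< a c ≡ 1
χ<-yes {zero} {suc c} _ = refl
χ<-yes {suc a} {suc c} (s≤s a<c) = χ<-yes a<c

χ<-no : ∀ {a c} → c ≤ a → χ< a c ≡ 0
χ<-no {a} {zero} _ = refl
χ<-no {suc a} {suc c} (s≤s c≤a) = χ<-no c≤a

χ<-≤1 : ∀ a c → χ< a c ≤ 1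
χ<-≤1 a zero = z≤n
χ<-≤1 zero (suc c) = ≤-refl
χ<-≤1 (suc a) (suc c) = χ<-≤1 a c

χ<-asym : ∀ a c → χ< a c + χ< c a ≤ 1
χ<-asym a zero = χ<-≤1 zero a
χ<-asym zero (suc c) = ≤-refl
χ<-asym (suc a) (suc c) = χ<-asym a c

χ≡ : ℕ → ℕ → ℕ
χ≡ zero zero = 1
χ≡ zero (suc _) = 0
χ≡ (suc _) zero = 0
χ≡ (suc a) (suc b) = χ≡ a b

χ≡-refl : ∀ a → χ≡ a a ≡ 1
χ≡-refl zero = refl
χ≡-refl (suc a) = χ≡-refl a

χ≡-no : ∀ {a b} → a ≢ b → χ≡ a b ≡ 0
χ≡-no {zero} {zero} a≢b = ⊥-elim (a≢b refl)
χ≡-no {zero} {suc b} _ = refl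
χ≡-no {suc a} {zero} _ = refl
χ≡-no {suc a} {suc b} a≢b = χ≡-no (λ e → a≢b (cong suc e))

χ≡-≤1 : ∀ a b → χ≡ a b ≤ 1
χ≡-≤1 a b with a ≟ b
... | yes refl = ≤-reflexive (χ≡-refl a)
... | no a≢b = ≤-trans (≤-reflexive (χ≡-no a≢b)) z≤n

sumTo-χ≡-below : ∀ i j → j < i → sumTo (λ k → χ≡ k i) j ≡ 0
sumTo-χ≡-below i zero j<i = χ≡-no (<⇒≢ j<i)
sumTo-χ≡-below i (suc j) j<i = cong₂ _+_ (sumTo-χ≡-below i j (<-trans (n<1+n j) j<i)) (χ≡-no (<⇒≢ j<i))

sumTo-χ≡-≤1 : ∀ i m → sumTo (λ k → χ≡ k i) m ≤ 1
sumTo-χ≡-≤1 i m with i ≤? m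
... | yes i≤m = ≤-reflexive (hit m i≤m)
  where
  hit : ∀ m → i ≤ m → sumTo (λ k → χ≡ k i) m ≡ 1
  hit zero z≤n = refl
  hit (suc m) i≤ with i ≟ suc m
  ... | yes refl = trans (cong (_+ χ≡ (suc m) (suc m)) (sumTo-χ≡-below (suc m) m ≤-refl)) (χ≡-refl (suc m))
  ... | no i≢ = trans (cong₂ _+_ (hit m (≤-pred (≤∧≢⇒< i≤ i≢))) (χ≡-no (λ e → i≢ (sym e)))) (+-identityʳ 1)
... | no i≰m = ≤-trans (≤-reflexive (sumTo-χ≡-below i m (≰⇒> i≰m))) z≤n

-- Vertices as sequences

at : ∀ {l} → Vec ℕ l → ℕ → ℕ
at [] k = 0
at (x ∷ v) zero = x
at (x ∷ v) (suc k) = at v k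

lookup≡at : ∀ {l} (v : Vec ℕ l) (j : Fin l) → lookup v j ≡ at v (toℕ j)
lookup≡at (x ∷ v) fzero = refl
lookup≡at (x ∷ v) (fsuc j) = lookup≡at v j

lookup-fromℕ<≡at : ∀ {l} (v : Vec ℕ l) k (k<l : k < l) → lookup v (fromℕ< k<l) ≡ at v k
lookup-fromℕ<≡at v k k<l = trans (lookup≡at v (fromℕ< k<l)) (cong (at v) (toℕ-fromℕ< k<l))

at-ext : ∀ {l} (u v : Vec ℕ l) → (∀ k → k < l → at u k ≡ at v k) → u ≡ v
at-ext [] [] _ = refl
at-ext (x ∷ u) (y ∷ v) h = cong₂ _∷_ (h 0 (s≤s z≤n)) (at-ext u v (λ k k< → h (suc k) (s≤s k<)))

at-replicate : ∀ l k → at (replicate l 0) k ≡ 0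
at-replicate zero k = refl
at-replicate (suc l) zero = refl
at-replicate (suc l) (suc k) = at-replicate l k

sum≡sumTo-at : ∀ {l} (v : Vec ℕ (suc l)) → sum v ≡ sumTo (at v) l
sum≡sumTo-at {zero} (x ∷ []) = +-identityʳ x
sum≡sumTo-at {suc l} (x ∷ v) = trans (cong (x +_) (sum≡sumTo-at v)) (sym (sumTo-unfoldˡ (at (x ∷ v)) l))

tabulateℕ : ∀ l → (ℕ → ℕ) → Vec ℕ l
tabulateℕ zero f = []
tabulateℕ (suc l) f = f 0 ∷ tabulateℕ l (λ k → f (suc k))

at-tabulateℕ : ∀ l (f : ℕ → ℕ) k → k < l → at (tabulateℕ l f) k ≡ f k
at-tabulateℕ (suc l) f zero _ = refl
at-tabulateℕ (suc l) f (suc k) (s≤s k<l) = at-tabulateℕ l (λ k → f (suc k)) k k<l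

IsBucketℕ : ℕ → ℕ → Set
IsBucketℕ m k = (k ≡ 0) ⊎ (k ≡ suc m)

bucket? : ∀ m k → Dec (IsBucketℕ m k)
bucket? m k with k ≟ 0 | k ≟ suc m
... | yes k≡0 | _ = yes (inj₁ k≡0)
... | no _ | yes k≡sm = yes (inj₂ k≡sm)
... | no k≢0 | no k≢sm = no [ k≢0 , k≢sm ]

interior : ∀ {m k} → 1 ≤ k → k ≤ m → ¬ IsBucketℕ m k
interior 1≤k _ (inj₁ refl) = <⇒≢ 1≤k refl
interior _ k≤m (inj₂ refl) = <⇒≢ (s≤s k≤m) refl

Fits : ℕ → ℕ → ℕ → ℕ → Set
Fits n m k x = (IsBucketℕ m k → x < n) × (¬ IsBucketℕ m k → x ≤ 1)

ValidSeq : ℕ → (m : ℕ) → (ℕ → ℕ) → Set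
ValidSeq n m g = (∀ k → k ≤ suc m → Fits n m k (g k)) × (n ∣ sumTo g (suc m))

ValidSeq-intro : ∀ {n m g} → g 0 < n → g (suc m) < n → (∀ k → 1 ≤ k → k ≤ m → g k ≤ 1) →
  n ∣ sumTo g (suc m) → ValidSeq n m g
ValidSeq-intro {n} {m} {g} g0<n gl<n bits div = fits , div
  where
  fits : ∀ k → k ≤ suc m → Fits n m k (g k)
  fits k k≤ = bucket , inside
    where
    bucket : IsBucketℕ m k → g k < n
    bucket (inj₁ refl) = g0<n
    bucket (inj₂ refl) = gl<n
    inside : ¬ IsBucketℕ m k → g k ≤ 1
    inside k∉ = bits k (n≢0⇒n>0 (λ e → k∉ (inj₁ e))) (≤-pred (≤∧≢⇒< k≤ (λ e → k∉ (inj₂ e))))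

first<n : ∀ {n m g} → ValidSeq n m g → g 0 < n
first<n (fits , _) = proj₁ (fits 0 z≤n) (inj₁ refl)

last<n : ∀ {n m g} → ValidSeq n m g → g (suc m) < n
last<n (fits , _) = proj₁ (fits _ ≤-refl) (inj₂ refl)

interior≤1 : ∀ {n m g} → ValidSeq n m g → ∀ k → 1 ≤ k → k ≤ m → g k ≤ 1
interior≤1 (fits , _) k 1≤k k≤m = proj₂ (fits k (m≤n⇒m≤1+n k≤m)) (interior 1≤k k≤m)

ValidSeq-cong : ∀ n m {f g : ℕ → ℕ} → (∀ k → k ≤ suc m → f k ≡ g k) → ValidSeq n m f → ValidSeq n m g
ValidSeq-cong n m f≗g (fits , div) =
  (λ k k≤ → subst (Fits n m k) (f≗g k k≤) (fits k k≤)) , subst (n ∣_) (sumTo-cong (suc m) f≗g) div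

Valid⇒ValidSeq : ∀ n m (v : Coord m) → Valid n m v → ValidSeq n m (at v)
Valid⇒ValidSeq n m v (buckets , inside , div) = fits , subst (n ∣_) (sum≡sumTo-at v) div
  where
  fits : ∀ k → k ≤ suc m → Fits n m k (at v k)
  fits k k≤ = subst (Fits n m k) (lookup-fromℕ<≡at v k (s≤s k≤))
    (subst (λ t → Fits n m t (lookup v j)) (toℕ-fromℕ< (s≤s k≤)) (buckets j , inside j))
    where
    j = fromℕ< (s≤s k≤)

ValidSeq⇒Valid : ∀ n m (v : Coord m) → ValidSeq n m (at v) → Valid n m v
ValidSeq⇒Valid n m v (fits , div) =
  (λ j → subst (λ t → IsBucket m j → t < n) (sym (lookup≡at v j)) (proj₁ (fits (toℕ j) (≤-pred (toℕ<n j))))) ,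
  (λ j → subst (λ t → ¬ IsBucket m j → t ≤ 1) (sym (lookup≡at v j)) (proj₂ (fits (toℕ j) (≤-pred (toℕ<n j))))) ,
  subst (n ∣_) (sym (sum≡sumTo-at v)) div

ValidSeq⇒Valid-tabulateℕ : ∀ n m (g : ℕ → ℕ) → ValidSeq n m g → Valid n m (tabulateℕ (suc (suc m)) g)
ValidSeq⇒Valid-tabulateℕ n m g valid = ValidSeq⇒Valid n m _
  (ValidSeq-cong n m (λ k k≤ → sym (at-tabulateℕ (suc (suc m)) g k (s≤s k≤))) valid)

lookup-inject₁≡at : ∀ {m} (x : Coord m) (i : Fin (suc m)) → lookup x (inject₁ i) ≡ at x (toℕ i)
lookup-inject₁≡at x i = trans (lookup≡at x (inject₁ i)) (cong (at x) (toℕ-inject₁ i))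

agreeℕ : ∀ {m} (u v : Coord m) (i : Fin (suc m)) →
  (∀ j → toℕ j ≢ toℕ i → toℕ j ≢ suc (toℕ i) → lookup u j ≡ lookup v j) →
  ∀ k → k ≤ suc m → k ≢ toℕ i → k ≢ suc (toℕ i) → at u k ≡ at v k
agreeℕ u v i agree k k≤ k≢i k≢si =
  trans (sym (lookup-fromℕ<≡at u k (s≤s k≤)))
    (trans (agree (fromℕ< (s≤s k≤)) (λ e → k≢i (trans (sym toℕk) e)) (λ e → k≢si (trans (sym toℕk) e)))
      (lookup-fromℕ<≡at v k (s≤s k≤)))
  where
  toℕk : toℕ (fromℕ< (s≤s k≤)) ≡ k
  toℕk = toℕ-fromℕ< (s≤s k≤)

Succℕ : ℕ → ℕ → ℕ → ℕ → ℕ → Set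
Succℕ n m k x y = (IsBucketℕ m k × ((suc x < n × y ≡ suc x) ⊎ (suc x ≡ n × y ≡ 0))) ⊎ (¬ IsBucketℕ m k × y ≡ suc x)

-- gv arises from gu by moving one unit from position i to position i + 1 (an edge of Y_{n,m}).
record RightMove (n m : ℕ) (gu gv : ℕ → ℕ) (i : ℕ) : Set where
  field
    others : ∀ k → k ≤ suc m → k ≢ i → k ≢ suc i → gu k ≡ gv k
    source : Succℕ n m i (gv i) (gu i)
    target : Succℕ n m (suc i) (gu (suc i)) (gv (suc i))

Succ-inject₁⇒Succℕ : ∀ {n m} (i : Fin (suc m)) (x y : Coord m) →
  Succ n m (inject₁ i) (lookup x (inject₁ i)) (lookup y (inject₁ i)) → Succℕ n m (toℕ i) (at x (toℕ i)) (at y (toℕ i))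
Succ-inject₁⇒Succℕ {n} {m} i x y s = subst (λ t → Succℕ n m t (at x (toℕ i)) (at y (toℕ i))) (toℕ-inject₁ i)
  (subst₂ (Succℕ n m (toℕ (inject₁ i))) (lookup-inject₁≡at x i) (lookup-inject₁≡at y i) s)

Succ-fsuc⇒Succℕ : ∀ {n m} (i : Fin (suc m)) (x y : Coord m) →
  Succ n m (fsuc i) (lookup x (fsuc i)) (lookup y (fsuc i)) → Succℕ n m (suc (toℕ i)) (at x (suc (toℕ i))) (at y (suc (toℕ i)))
Succ-fsuc⇒Succℕ {n} {m} i x y = subst₂ (Succℕ n m (suc (toℕ i))) (lookup≡at x (fsuc i)) (lookup≡at y (fsuc i))

Adj⇒RightMove : ∀ n m (u v : Coord m) → Adj n m u v →
  Σ ℕ λ i → i ≤ m × (RightMove n m (at u) (at v) i ⊎ RightMove n m (at v) (at u) i)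
Adj⇒RightMove n m u v (i , agree , inj₁ (s₁ , s₂)) = toℕ i , ≤-pred (toℕ<n i) , inj₁ (record
  { others = agreeℕ u v i agree
  ; source = Succ-inject₁⇒Succℕ i v u s₁
  ; target = Succ-fsuc⇒Succℕ i u v s₂ })
Adj⇒RightMove n m u v (i , agree , inj₂ (s₁ , s₂)) = toℕ i , ≤-pred (toℕ<n i) , inj₂ (record
  { others = λ k k≤ k≢i k≢si → sym (agreeℕ u v i agree k k≤ k≢i k≢si)
  ; source = Succ-inject₁⇒Succℕ i u v s₁
  ; target = Succ-fsuc⇒Succℕ i v u s₂ })

RightMove⇒Adj : ∀ n m (u v : Coord m) i → i ≤ m → RightMove n m (at u) (at v) i → Adj n m u v
RightMove⇒Adj n m u v i i≤m move = j , agree , inj₁ (source′ , target′)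
  where
  open RightMove move
  j : Fin (suc m)
  j = fromℕ< (s≤s i≤m)
  toℕj : toℕ j ≡ i
  toℕj = toℕ-fromℕ< (s≤s i≤m)
  agree : ∀ l → toℕ l ≢ toℕ j → toℕ l ≢ suc (toℕ j) → lookup u l ≡ lookup v l
  agree l l≢j l≢sj = trans (lookup≡at u l) (trans
    (others (toℕ l) (≤-pred (toℕ<n l)) (λ e → l≢j (trans e (sym toℕj))) (λ e → l≢sj (trans e (cong suc (sym toℕj)))))
    (sym (lookup≡at v l)))
  atⱼ : ∀ x → lookup x (inject₁ j) ≡ at x i
  atⱼ x = trans (lookup-inject₁≡at x j) (cong (at x) toℕj)
  atₛⱼ : ∀ x → lookup x (fsuc j) ≡ at x (suc i)
  atₛⱼ x = trans (lookup≡at x (fsuc j)) (cong (λ t → at x (suc t)) toℕj)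
  source′ : Succ n m (inject₁ j) (lookup v (inject₁ j)) (lookup u (inject₁ j))
  source′ = subst₂ (Succℕ n m (toℕ (inject₁ j))) (sym (atⱼ v)) (sym (atⱼ u))
    (subst (λ t → Succℕ n m t (at v i) (at u i)) (sym (trans (toℕ-inject₁ j) toℕj)) source)
  target′ : Succ n m (fsuc j) (lookup u (fsuc j)) (lookup v (fsuc j))
  target′ = subst₂ (Succℕ n m (toℕ (fsuc j))) (sym (atₛⱼ u)) (sym (atₛⱼ v))
    (subst (λ t → Succℕ n m (suc t) (at u (suc i)) (at v (suc i))) (sym toℕj) target)

Adj-sym : ∀ {n m} {u v : Coord m} → Adj n m u v → Adj n m v u
Adj-sym (i , agree , moves) = i , (λ j j≢i j≢si → sym (agree j j≢i j≢si)) , [ inj₂ , inj₁ ] moves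

-- Prefix sums and the lower bound on distances

spread : ℕ → (ℕ → ℕ) → ℕ → ℕ
spread m x c = sumTo (λ k → ∣ x k - c ∣) m

cost : ℕ → ℕ → (ℕ → ℕ) → ℕ → ℕ
cost n m g q = spread m (sumTo g) (q * n)

-- The arithmetic content of a RightMove: w and w′ record a wrap-around of Z_n,
-- possible only in a bucket.
record UnitShift (n m : ℕ) (gu gv : ℕ → ℕ) (i w w′ : ℕ) : Set where
  field
    others : ∀ k → k ≤ suc m → k ≢ i → k ≢ suc i → gu k ≡ gv k
    source : gu i + n * w ≡ suc (gv i)
    source-carry : w ≡ 0 ⊎ i ≡ 0
    target : gv (suc i) + n * w′ ≡ suc (gu (suc i))
    target-carry : w′ ≡ 0 ⊎ i ≡ m

PrefixStep : ℕ → ℕ → (ℕ → ℕ) → (ℕ → ℕ) → ℕ → ℕ → Set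
PrefixStep n m Pu Pv i w = ∀ k → k ≤ m → Pu k + n * w ≡ Pv k + χ≡ k i

+-extend : ∀ p p′ x x′ {c a b} → p + c ≡ p′ + a → x + a ≡ x′ + b → p + x + c ≡ p′ + x′ + b
+-extend p p′ x x′ {c} {a} {b} e₁ e₂ = begin
  p + x + c    ≡⟨ xy∙z≈xz∙y p x c ⟩
  p + c + x    ≡⟨ cong (_+ x) e₁ ⟩
  p′ + a + x   ≡⟨ +-assoc p′ a x ⟩
  p′ + (a + x) ≡⟨ cong (p′ +_) (trans (+-comm a x) e₂) ⟩
  p′ + (x′ + b) ≡⟨ sym (+-assoc p′ x′ b) ⟩
  p′ + x′ + b  ∎
  where open ≡-Reasoning

m+n*0≡m : ∀ n x → x + n * 0 ≡ x
m+n*0≡m n x = trans (cong (x +_) (*-zeroʳ n)) (+-identityʳ x)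

module UnitShiftProperties {n m gu gv i w w′} (s : UnitShift n m gu gv i w w′) where
  open UnitShift s

  private
    no-source-carry : i ≢ 0 → w ≡ 0
    no-source-carry i≢0 = [ (λ e → e) , (λ e → ⊥-elim (i≢0 e)) ] source-carry

    no-target-carry : i ≢ m → w′ ≡ 0
    no-target-carry i≢m = [ (λ e → e) , (λ e → ⊥-elim (i≢m e)) ] target-carry

    source-interior : i ≢ 0 → gu i + 0 ≡ gv i + 1
    source-interior i≢0 = begin
      gu i + 0     ≡⟨ +-identityʳ (gu i) ⟩
      gu i         ≡⟨ sym (m+n*0≡m n (gu i)) ⟩
      gu i + n * 0 ≡⟨ cong (λ t → gu i + n * t) (sym (no-source-carry i≢0)) ⟩
      gu i + n * w ≡⟨ source ⟩
      suc (gv i)   ≡⟨ +-comm 1 (gv i) ⟩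
      gv i + 1     ∎
      where open ≡-Reasoning

    target-interior : i ≢ m → gu (suc i) + 1 ≡ gv (suc i) + 0
    target-interior i≢m = begin
      gu (suc i) + 1          ≡⟨ +-comm (gu (suc i)) 1 ⟩
      suc (gu (suc i))        ≡⟨ sym target ⟩
      gv (suc i) + n * w′     ≡⟨ cong (λ t → gv (suc i) + n * t) (no-target-carry i≢m) ⟩
      gv (suc i) + n * 0      ≡⟨ m+n*0≡m n (gv (suc i)) ⟩
      gv (suc i)              ≡⟨ sym (+-identityʳ (gv (suc i))) ⟩
      gv (suc i) + 0          ∎
      where open ≡-Reasoning

    local-step : ∀ k → suc k ≤ m → gu (suc k) + χ≡ k i ≡ gv (suc k) + χ≡ (suc k) i
    local-step k sk≤m with suc k ≟ i | k ≟ i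
    ... | yes refl | _ rewrite χ≡-no (<⇒≢ (n<1+n k)) | χ≡-refl i = source-interior (λ ())
    ... | no sk≢i | yes refl rewrite χ≡-refl k | χ≡-no sk≢i = target-interior (<⇒≢ sk≤m)
    ... | no sk≢i | no k≢i rewrite χ≡-no k≢i | χ≡-no sk≢i =
      cong (_+ 0) (others (suc k) (m≤n⇒m≤1+n sk≤m) sk≢i (λ e → k≢i (suc-injective e)))

  prefix-step : PrefixStep n m (sumTo gu) (sumTo gv) i w
  prefix-step zero _ with i ≟ 0
  ... | yes refl = trans source (+-comm 1 (gv 0))
  ... | no i≢0 = begin
    gu 0 + n * w    ≡⟨ cong (λ t → gu 0 + n * t) (no-source-carry i≢0) ⟩
    gu 0 + n * 0    ≡⟨ m+n*0≡m n (gu 0) ⟩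
    gu 0            ≡⟨ others 0 z≤n (λ e → i≢0 (sym e)) (λ ()) ⟩
    gv 0            ≡⟨ sym (+-identityʳ _) ⟩
    gv 0 + 0        ≡⟨ cong (gv 0 +_) (sym (χ≡-no (λ e → i≢0 (sym e)))) ⟩
    gv 0 + χ≡ 0 i   ∎
    where open ≡-Reasoning
  prefix-step (suc k) sk≤m = +-extend (sumTo gu k) (sumTo gv k) (gu (suc k)) (gv (suc k)) (prefix-step k (<⇒≤ sk≤m)) (local-step k sk≤m)

  total : i ≤ m → sumTo gu (suc m) + n * w ≡ sumTo gv (suc m) + n * w′
  total i≤m = +-extend (sumTo gu m) (sumTo gv m) (gu (suc m)) (gv (suc m)) (prefix-step m ≤-refl) last
    where
    last : gu (suc m) + χ≡ m i ≡ gv (suc m) + n * w′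
    last with i ≟ m
    ... | yes refl rewrite χ≡-refl i = trans (+-comm (gu (suc i)) 1) (sym target)
    ... | no i≢m rewrite χ≡-no (λ e → i≢m (sym e)) = begin
      gu (suc m) + 0      ≡⟨ +-identityʳ _ ⟩
      gu (suc m)          ≡⟨ others (suc m) ≤-refl (λ e → <⇒≢ (s≤s i≤m) (sym e)) (λ e → i≢m (sym (suc-injective e))) ⟩
      gv (suc m)          ≡⟨ sym (m+n*0≡m n (gv (suc m))) ⟩
      gv (suc m) + n * 0  ≡⟨ cong (λ t → gv (suc m) + n * t) (sym (no-target-carry i≢m)) ⟩
      gv (suc m) + n * w′ ∎
      where open ≡-Reasoning

∣x+e-c∣≤∣x-c∣+e : ∀ x e c → ∣ x + e - c ∣ ≤ ∣ x - c ∣ + e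
∣x+e-c∣≤∣x-c∣+e x e c = begin
  ∣ x + e - c ∣             ≤⟨ ∣-∣-triangle (x + e) x c ⟩
  ∣ x + e - x ∣ + ∣ x - c ∣ ≡⟨ cong (_+ ∣ x - c ∣) (trans (∣-∣-comm (x + e) x) (∣m-m+n∣≡n x e)) ⟩
  e + ∣ x - c ∣             ≡⟨ +-comm e _ ⟩
  ∣ x - c ∣ + e             ∎
  where open ≤-Reasoning

∣x-c∣≤∣x+e-c∣+e : ∀ x e c → ∣ x - c ∣ ≤ ∣ x + e - c ∣ + e
∣x-c∣≤∣x+e-c∣+e x e c = begin
  ∣ x - c ∣                 ≤⟨ ∣-∣-triangle x (x + e) c ⟩
  ∣ x - x + e ∣ + ∣ x + e - c ∣ ≡⟨ cong (_+ ∣ x + e - c ∣) (∣m-m+n∣≡n x e) ⟩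
  e + ∣ x + e - c ∣         ≡⟨ +-comm e _ ⟩
  ∣ x + e - c ∣ + e         ∎
  where open ≤-Reasoning

spread-≤-bump : ∀ m (x y : ℕ → ℕ) c d i → (∀ k → k ≤ m → ∣ x k - c ∣ ≤ ∣ y k - d ∣ + χ≡ k i) →
  spread m x c ≤ spread m y d + 1
spread-≤-bump m x y c d i pointwise = begin
  spread m x c                                       ≤⟨ sumTo-mono-≤ m pointwise ⟩
  sumTo (λ k → ∣ y k - d ∣ + χ≡ k i) m               ≡⟨ sumTo-+ _ _ m ⟩
  spread m y d + sumTo (λ k → χ≡ k i) m              ≤⟨ +-monoʳ-≤ (spread m y d) (sumTo-χ≡-≤1 i m) ⟩
  spread m y d + 1                                   ∎
  where open ≤-Reasoning

[q+w]*n≡q*n+n*w : ∀ n q w → (q + w) * n ≡ q * n + n * w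
[q+w]*n≡q*n+n*w n q w = trans (*-distribʳ-+ n q w) (cong (q * n +_) (*-comm w n))

PrefixStep⇒spread-forward : ∀ n m Pu Pv i w → PrefixStep n m Pu Pv i w →
  ∀ q → spread m Pv ((q + w) * n) ≤ spread m Pu (q * n) + 1
PrefixStep⇒spread-forward n m Pu Pv i w shift q = spread-≤-bump m Pv Pu _ _ i pointwise
  where
  pointwise : ∀ k → k ≤ m → ∣ Pv k - (q + w) * n ∣ ≤ ∣ Pu k - q * n ∣ + χ≡ k i
  pointwise k k≤m = begin
    ∣ Pv k - (q + w) * n ∣               ≤⟨ ∣x-c∣≤∣x+e-c∣+e (Pv k) (χ≡ k i) _ ⟩
    ∣ Pv k + χ≡ k i - (q + w) * n ∣ + χ≡ k i ≡⟨ cong (λ t → ∣ t - (q + w) * n ∣ + χ≡ k i) (sym (shift k k≤m)) ⟩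
    ∣ Pu k + n * w - (q + w) * n ∣ + χ≡ k i ≡⟨ cong (_+ χ≡ k i) (cong₂ ∣_-_∣ (+-comm (Pu k) (n * w)) (trans ([q+w]*n≡q*n+n*w n q w) (+-comm (q * n) (n * w)))) ⟩
    ∣ n * w + Pu k - n * w + q * n ∣ + χ≡ k i ≡⟨ cong (_+ χ≡ k i) (∣m+n-m+o∣≡∣n-o∣ (n * w) (Pu k) (q * n)) ⟩
    ∣ Pu k - q * n ∣ + χ≡ k i           ∎
    where open ≤-Reasoning

PrefixStep⇒spread-backward : ∀ n m Pu Pv i w → w ≤ 1 → PrefixStep n m Pu Pv i w →
  ∀ q → Σ ℕ λ q′ → spread m Pu (q′ * n) ≤ spread m Pv (q * n) + 1
PrefixStep⇒spread-backward n m Pu Pv i zero _ shift q = q , spread-≤-bump m Pu Pv _ _ i pointwise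
  where
  pointwise : ∀ k → k ≤ m → ∣ Pu k - q * n ∣ ≤ ∣ Pv k - q * n ∣ + χ≡ k i
  pointwise k k≤m = subst (λ t → ∣ t - q * n ∣ ≤ _) (trans (sym (shift k k≤m)) (m+n*0≡m n (Pu k)))
    (∣x+e-c∣≤∣x-c∣+e (Pv k) (χ≡ k i) (q * n))
PrefixStep⇒spread-backward n m Pu Pv i (suc zero) _ shift zero = 0 , spread-≤-bump m Pu Pv _ _ i pointwise
  where
  pointwise : ∀ k → k ≤ m → ∣ Pu k - 0 ∣ ≤ ∣ Pv k - 0 ∣ + χ≡ k i
  pointwise k k≤m = begin
    ∣ Pu k - 0 ∣        ≡⟨ ∣-∣-identityʳ (Pu k) ⟩
    Pu k                ≤⟨ m≤m+n (Pu k) (n * 1) ⟩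
    Pu k + n * 1        ≡⟨ shift k k≤m ⟩
    Pv k + χ≡ k i       ≡⟨ cong (_+ χ≡ k i) (sym (∣-∣-identityʳ (Pv k))) ⟩
    ∣ Pv k - 0 ∣ + χ≡ k i ∎
    where open ≤-Reasoning
PrefixStep⇒spread-backward n m Pu Pv i (suc zero) _ shift (suc q) = q , spread-≤-bump m Pu Pv _ _ i pointwise
  where
  pointwise : ∀ k → k ≤ m → ∣ Pu k - q * n ∣ ≤ ∣ Pv k - suc q * n ∣ + χ≡ k i
  pointwise k k≤m = begin
    ∣ Pu k - q * n ∣                ≡⟨ sym (∣m+n-m+o∣≡∣n-o∣ n (Pu k) (q * n)) ⟩
    ∣ n + Pu k - n + q * n ∣        ≡⟨ cong (λ t → ∣ t - suc q * n ∣) (trans (+-comm n (Pu k)) (trans (cong (Pu k +_) (sym (*-identityʳ n))) (shift k k≤m))) ⟩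
    ∣ Pv k + χ≡ k i - suc q * n ∣   ≤⟨ ∣x+e-c∣≤∣x-c∣+e (Pv k) (χ≡ k i) (suc q * n) ⟩
    ∣ Pv k - suc q * n ∣ + χ≡ k i   ∎
    where open ≤-Reasoning
PrefixStep⇒spread-backward n m Pu Pv i (suc (suc w)) (s≤s ()) shift q

Succℕ⇒carry : ∀ n m k x y → Succℕ n m k x y → Σ ℕ λ w → w ≤ 1 × (y + n * w ≡ suc x) × (w ≡ 0 ⊎ IsBucketℕ m k)
Succℕ⇒carry n m k x y (inj₁ (_ , inj₁ (_ , y≡))) = 0 , z≤n , trans (m+n*0≡m n y) y≡ , inj₁ refl
Succℕ⇒carry n m k x y (inj₁ (b , inj₂ (sx≡n , y≡0))) = 1 , ≤-refl , trans (cong₂ _+_ y≡0 (*-identityʳ n)) (sym sx≡n) , inj₂ b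
Succℕ⇒carry n m k x y (inj₂ (_ , y≡)) = 0 , z≤n , trans (m+n*0≡m n y) y≡ , inj₁ refl

RightMove⇒UnitShift : ∀ {n m gu gv i} → i ≤ m → RightMove n m gu gv i →
  Σ ℕ λ w → Σ ℕ λ w′ → w ≤ 1 × UnitShift n m gu gv i w w′
RightMove⇒UnitShift {n} {m} {gu} {gv} {i} i≤m move
  with Succℕ⇒carry n m _ _ _ (RightMove.source move) | Succℕ⇒carry n m _ _ _ (RightMove.target move)
... | w , w≤1 , e₁ , c₁ | w′ , _ , e₂ , c₂ = w , w′ , w≤1 , record
  { others = RightMove.others move
  ; source = e₁
  ; source-carry = map₂ first-bucket c₁
  ; target = e₂
  ; target-carry = map₂ (λ { (inj₁ ()) ; (inj₂ e) → suc-injective e }) c₂ }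
  where
  first-bucket : IsBucketℕ m i → i ≡ 0
  first-bucket (inj₁ e) = e
  first-bucket (inj₂ e) = ⊥-elim (<⇒≢ (s≤s i≤m) e)

Adj⇒cost-≤ : ∀ n m (x y : Coord m) → Adj n m x y → ∀ q → Σ ℕ λ q′ → cost n m (at y) q′ ≤ cost n m (at x) q + 1
Adj⇒cost-≤ n m x y adj q with Adj⇒RightMove n m x y adj
... | i , i≤m , inj₁ move with RightMove⇒UnitShift i≤m move
...   | w , _ , _ , s = q + w , PrefixStep⇒spread-forward n m _ _ i w (UnitShiftProperties.prefix-step s) q
Adj⇒cost-≤ n m x y adj q | i , i≤m , inj₂ move with RightMove⇒UnitShift i≤m move
...   | w , _ , w≤1 , s = PrefixStep⇒spread-backward n m _ _ i w w≤1 (UnitShiftProperties.prefix-step s) q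

Walk⇒cost-≤ : ∀ n m {x y : Coord m} {k} → Walk n m x y k → ∀ q → Σ ℕ λ q′ → cost n m (at y) q′ ≤ cost n m (at x) q + k
Walk⇒cost-≤ n m here q = q , m≤m+n _ 0
Walk⇒cost-≤ n m {x} {k = suc k} (step {y = x′} _ adj _ walk) q with Adj⇒cost-≤ n m x x′ adj q
... | q₁ , c₁ with Walk⇒cost-≤ n m walk q₁
... | q′ , c′ = q′ , ≤-trans c′ (≤-trans (+-monoˡ-≤ k c₁) (≤-reflexive (+-assoc (cost n m (at x) q) 1 k)))

-- Descent towards 0 and the distance formula

unit-up : ∀ n m k x → 1 ≤ n → Fits n m k x → (¬ IsBucketℕ m k → x ≡ 0) →
  Σ ℕ λ y → Fits n m k y × Succℕ n m k x y
unit-up n m k x 1≤n (x<n , _) empty with bucket? m k | suc x <? n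
... | yes b | yes sx<n = suc x , ((λ _ → sx<n) , (λ k∉ → ⊥-elim (k∉ b))) , inj₁ (b , inj₁ (sx<n , refl))
... | yes b | no sx≮n = 0 , ((λ _ → 1≤n) , (λ k∉ → ⊥-elim (k∉ b))) , inj₁ (b , inj₂ (≤-antisym (x<n b) (≮⇒≥ sx≮n) , refl))
... | no k∉ | _ = suc x , ((λ b → ⊥-elim (k∉ b)) , (λ _ → s≤s (≤-reflexive (empty k∉)))) , inj₂ (k∉ , refl)

unit-down : ∀ n m k x → 1 ≤ n → Fits n m k x → (¬ IsBucketℕ m k → x ≡ 1) →
  Σ ℕ λ y → Fits n m k y × Succℕ n m k y x
unit-down n m k (suc y) _ (x<n , x≤1) _ = y , ((λ b → <-trans (n<1+n y) (x<n b)) , (λ k∉ → ≤-trans (n≤1+n y) (x≤1 k∉))) , succ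
  where
  succ : Succℕ n m k y (suc y)
  succ with bucket? m k
  ... | yes b = inj₁ (b , inj₁ (x<n b , refl))
  ... | no k∉ = inj₂ (k∉ , refl)
unit-down (suc n) m k zero _ (x<n , _) full with bucket? m k
... | yes b = n , ((λ _ → n<1+n n) , (λ k∉ → ⊥-elim (k∉ b))) , inj₁ (b , inj₂ (refl , refl))
... | no k∉ = ⊥-elim (0≢1+n (full k∉))

update₂ : (ℕ → ℕ) → ℕ → ℕ → ℕ → ℕ → ℕ
update₂ g i a b k with k ≟ i | k ≟ suc i
... | yes _ | _ = a
... | no _ | yes _ = b
... | no _ | no _ = g k

update₂-i : ∀ g i a b → update₂ g i a b i ≡ a
update₂-i g i a b with i ≟ i
... | yes _ = refl
... | no i≢i = ⊥-elim (i≢i refl)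

update₂-suc : ∀ g i a b → update₂ g i a b (suc i) ≡ b
update₂-suc g i a b with suc i ≟ i | suc i ≟ suc i
... | yes si≡i | _ = ⊥-elim (<⇒≢ (n<1+n i) (sym si≡i))
... | no _ | yes _ = refl
... | no _ | no si≢si = ⊥-elim (si≢si refl)

update₂-other : ∀ g i a b k → k ≢ i → k ≢ suc i → update₂ g i a b k ≡ g k
update₂-other g i a b k k≢i k≢si with k ≟ i | k ≟ suc i
... | yes k≡i | _ = ⊥-elim (k≢i k≡i)
... | no _ | yes k≡si = ⊥-elim (k≢si k≡si)
... | no _ | no _ = refl

position : ∀ k i → (k ≡ i) ⊎ (k ≡ suc i) ⊎ (k ≢ i × k ≢ suc i)
position k i with k ≟ i | k ≟ suc i
... | yes k≡i | _ = inj₁ k≡i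
... | no _ | yes k≡si = inj₂ (inj₁ k≡si)
... | no k≢i | no k≢si = inj₂ (inj₂ (k≢i , k≢si))

ValidSeq-update₂ : ∀ n m g i a b → ValidSeq n m g → Fits n m i a → Fits n m (suc i) b →
  n ∣ sumTo (update₂ g i a b) (suc m) → ValidSeq n m (update₂ g i a b)
ValidSeq-update₂ n m g i a b (fits , _) a-fits b-fits div = fits′ , div
  where
  fits′ : ∀ k → k ≤ suc m → Fits n m k (update₂ g i a b k)
  fits′ k k≤ = by-position (position k i)
    where
    by-position : (k ≡ i) ⊎ (k ≡ suc i) ⊎ (k ≢ i × k ≢ suc i) → Fits n m k (update₂ g i a b k)
    by-position (inj₁ refl) = subst (Fits n m k) (sym (update₂-i g i a b)) a-fits
    by-position (inj₂ (inj₁ refl)) = subst (Fits n m k) (sym (update₂-suc g i a b)) b-fits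
    by-position (inj₂ (inj₂ (k≢i , k≢si))) = subst (Fits n m k) (sym (update₂-other g i a b k k≢i k≢si)) (fits k k≤)

modify : ∀ m → Coord m → ℕ → ℕ → ℕ → Coord m
modify m y i a b = tabulateℕ (suc (suc m)) (update₂ (at y) i a b)

module _ {m} (y : Coord m) (i a b : ℕ) (i≤m : i ≤ m) where

  private
    at-modify : ∀ k → k ≤ suc m → at (modify m y i a b) k ≡ update₂ (at y) i a b k
    at-modify k k≤ = at-tabulateℕ (suc (suc m)) (update₂ (at y) i a b) k (s≤s k≤)

    at-modify-i : at (modify m y i a b) i ≡ a
    at-modify-i = trans (at-modify i (m≤n⇒m≤1+n i≤m)) (update₂-i (at y) i a b)

    at-modify-suc : at (modify m y i a b) (suc i) ≡ b
    at-modify-suc = trans (at-modify (suc i) (s≤s i≤m)) (update₂-suc (at y) i a b)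

    at-modify-other : ∀ k → k ≤ suc m → k ≢ i → k ≢ suc i → at y k ≡ at (modify m y i a b) k
    at-modify-other k k≤ k≢i k≢si = sym (trans (at-modify k k≤) (update₂-other (at y) i a b k k≢i k≢si))

  modify-valid : ∀ n → Valid n m y → Fits n m i a → Fits n m (suc i) b →
    n ∣ sumTo (at (modify m y i a b)) (suc m) → Valid n m (modify m y i a b)
  modify-valid n valid a-fits b-fits div = ValidSeq⇒Valid-tabulateℕ n m _
    (ValidSeq-update₂ n m (at y) i a b (Valid⇒ValidSeq n m y valid) a-fits b-fits
      (subst (n ∣_) (sumTo-cong (suc m) at-modify) div))

  modify-moveʳ : ∀ n → Succℕ n m i a (at y i) → Succℕ n m (suc i) (at y (suc i)) b →
    RightMove n m (at y) (at (modify m y i a b)) i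
  modify-moveʳ n source target = record
    { others = at-modify-other
    ; source = subst (λ t → Succℕ n m i t (at y i)) (sym at-modify-i) source
    ; target = subst (Succℕ n m (suc i) (at y (suc i))) (sym at-modify-suc) target }

  modify-moveˡ : ∀ n → Succℕ n m i (at y i) a → Succℕ n m (suc i) b (at y (suc i)) →
    RightMove n m (at (modify m y i a b)) (at y) i
  modify-moveˡ n source target = record
    { others = λ k k≤ k≢i k≢si → sym (at-modify-other k k≤ k≢i k≢si)
    ; source = subst (Succℕ n m i (at y i)) (sym at-modify-i) source
    ; target = subst (λ t → Succℕ n m (suc i) t (at y (suc i))) (sym at-modify-suc) target }

least : (Q : ℕ → Set) → (∀ k → Dec (Q k)) → ∀ m → Q m → Σ ℕ λ i → i ≤ m × Q i × (∀ j → j < i → ¬ Q j)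
least Q Q? m qm with Q? 0
... | yes q0 = 0 , z≤n , q0 , λ _ ()
least Q Q? zero qm | no ¬q0 = ⊥-elim (¬q0 qm)
least Q Q? (suc m) qm | no ¬q0 with least (λ k → Q (suc k)) (λ k → Q? (suc k)) m qm
... | i , i≤m , qi , before = suc i , s≤s i≤m , qi , λ { zero _ → ¬q0 ; (suc j) (s≤s j<i) → before j j<i }

greatest : (Q : ℕ → Set) → (∀ k → Dec (Q k)) → ∀ m → Q 0 → Σ ℕ λ i → i ≤ m × Q i × (∀ j → i < j → j ≤ m → ¬ Q j)
greatest Q Q? zero q0 = 0 , z≤n , q0 , λ j 0<j j≤0 → ⊥-elim (<⇒≱ 0<j j≤0)
greatest Q Q? (suc m) q0 with Q? (suc m)
... | yes qsm = suc m , ≤-refl , qsm , λ j sm<j j≤sm → ⊥-elim (<⇒≱ sm<j j≤sm)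
... | no ¬qsm with greatest Q Q? m q0
... | i , i≤m , qi , after = i , m≤n⇒m≤1+n i≤m , qi , after′
  where
  after′ : ∀ j → i < j → j ≤ suc m → ¬ Q j
  after′ j i<j j≤sm with j ≟ suc m
  ... | yes refl = ¬qsm
  ... | no j≢sm = after j i<j (≤-pred (≤∧≢⇒< j≤sm j≢sm))

flat⇒zero : ∀ g j → sumTo g (suc j) ≤ sumTo g j → g (suc j) ≡ 0
flat⇒zero g j P≤ = n≤0⇒n≡0 (+-cancelˡ-≤ (sumTo g j) _ 0 (≤-trans P≤ (≤-reflexive (sym (+-identityʳ _)))))

rise⇒unit : ∀ {n m} g → ValidSeq n m g → ∀ j → suc j ≤ m → sumTo g j ≢ sumTo g (suc j) → g (suc j) ≡ 1
rise⇒unit g valid j sj≤m P≢ = ≤-antisym (interior≤1 valid (suc j) (s≤s z≤n) sj≤m)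
  (n≢0⇒n>0 (λ g≡0 → P≢ (sym (trans (cong (sumTo g j +_) g≡0) (+-identityʳ _)))))

off-bucket : ∀ {m} i → ¬ IsBucketℕ m i → Σ ℕ λ j → i ≡ suc j
off-bucket zero i∉ = ⊥-elim (i∉ (inj₁ refl))
off-bucket (suc j) _ = j , refl

movable-unit-above : ∀ n m g → ValidSeq n m g → ∀ c → c < sumTo g m → Σ ℕ λ i → i ≤ m × c < sumTo g i ×
  (¬ IsBucketℕ m i → g i ≡ 1) × (¬ IsBucketℕ m (suc i) → g (suc i) ≡ 0)
movable-unit-above n m g valid c c<Pm with least (λ i → sumTo g i ≡ sumTo g m) (λ i → sumTo g i ≟ sumTo g m) m refl
... | i , i≤m , Pi≡Pm , before = i , i≤m , subst (c <_) (sym Pi≡Pm) c<Pm , full , empty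
  where
  full : ¬ IsBucketℕ m i → g i ≡ 1
  full i∉ with off-bucket i i∉
  ... | j , i≡sj = subst (λ t → g t ≡ 1) (sym i≡sj) (rise⇒unit g valid j (subst (_≤ m) i≡sj i≤m)
    (λ P≡ → before j (subst (j <_) (sym i≡sj) ≤-refl) (trans P≡ (subst (λ t → sumTo g t ≡ sumTo g m) i≡sj Pi≡Pm))))
  empty : ¬ IsBucketℕ m (suc i) → g (suc i) ≡ 0
  empty si∉ = flat⇒zero g i (subst (sumTo g (suc i) ≤_) (sym Pi≡Pm)
    (sumTo-monoʳ-≤ g (≤∧≢⇒< i≤m (λ e → si∉ (inj₂ (cong suc e))))))

movable-unit-below : ∀ n m g → ValidSeq n m g → ∀ c → sumTo g 0 < c → Σ ℕ λ i → i ≤ m × sumTo g i < c ×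
  (¬ IsBucketℕ m i → g i ≡ 0) × (¬ IsBucketℕ m (suc i) → g (suc i) ≡ 1)
movable-unit-below n m g valid c P0<c with greatest (λ i → sumTo g i ≡ sumTo g 0) (λ i → sumTo g i ≟ sumTo g 0) m refl
... | i , i≤m , Pi≡P0 , after = i , i≤m , subst (_< c) (sym Pi≡P0) P0<c , empty , full
  where
  empty : ¬ IsBucketℕ m i → g i ≡ 0
  empty i∉ with off-bucket i i∉
  ... | j , i≡sj = subst (λ t → g t ≡ 0) (sym i≡sj) (flat⇒zero g j
    (subst (_≤ sumTo g j) (sym (subst (λ t → sumTo g t ≡ sumTo g 0) i≡sj Pi≡P0)) (sumTo-monoʳ-≤ g {0} {j} z≤n)))
  full : ¬ IsBucketℕ m (suc i) → g (suc i) ≡ 1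
  full si∉ = rise⇒unit g valid i i<m (λ P≡ → after (suc i) ≤-refl i<m (trans (sym P≡) Pi≡P0))
    where
    i<m : i < m
    i<m = ≤∧≢⇒< i≤m (λ e → si∉ (inj₂ (cong suc e)))

∣m-n∣+1≡∣1+m-n∣ : ∀ {m n} → n ≤ m → ∣ m - n ∣ + 1 ≡ ∣ suc m - n ∣
∣m-n∣+1≡∣1+m-n∣ {m} {n} n≤m = begin
  ∣ m - n ∣ + 1 ≡⟨ cong (_+ 1) (m≤n⇒∣n-m∣≡n∸m n≤m) ⟩
  m ∸ n + 1     ≡⟨ +-comm (m ∸ n) 1 ⟩
  suc (m ∸ n)   ≡⟨ sym (+-∸-assoc 1 n≤m) ⟩
  suc m ∸ n     ≡⟨ sym (m≤n⇒∣n-m∣≡n∸m (m≤n⇒m≤1+n n≤m)) ⟩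
  ∣ suc m - n ∣ ∎
  where open ≡-Reasoning

∣1+m-n∣+1≡∣m-n∣ : ∀ {m n} → suc m ≤ n → ∣ suc m - n ∣ + 1 ≡ ∣ m - n ∣
∣1+m-n∣+1≡∣m-n∣ {m} {n} m<n = begin
  ∣ suc m - n ∣ + 1 ≡⟨ cong (_+ 1) (m≤n⇒∣m-n∣≡n∸m m<n) ⟩
  n ∸ suc m + 1     ≡⟨ +-comm (n ∸ suc m) 1 ⟩
  suc (n ∸ suc m)   ≡⟨ sym (+-∸-assoc 1 m<n) ⟩
  n ∸ m             ≡⟨ sym (m≤n⇒∣m-n∣≡n∸m (<⇒≤ m<n)) ⟩
  ∣ m - n ∣         ∎
  where open ≡-Reasoning

spread-+ : ∀ m (x : ℕ → ℕ) c d → spread m (λ k → x k + d) (c + d) ≡ spread m x c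
spread-+ m x c d = sumTo-cong m (λ k _ → trans (cong₂ ∣_-_∣ (+-comm (x k) d) (+-comm c d)) (∣m+n-m+o∣≡∣n-o∣ d (x k) c))

module _ (m : ℕ) (x y : ℕ → ℕ) (i c : ℕ) (i≤m : i ≤ m) (x≡ : ∀ k → k ≤ m → x k ≡ y k + χ≡ k i) where

  private
    elsewhere : ∀ k → k ≤ m → k ≢ i → x k ≡ y k
    elsewhere k k≤ k≢i = trans (x≡ k k≤) (trans (cong (y k +_) (χ≡-no k≢i)) (+-identityʳ _))

    at-i : x i ≡ suc (y i)
    at-i = trans (x≡ i i≤m) (trans (cong (y i +_) (χ≡-refl i)) (+-comm (y i) 1))

  spread-raise-above : c ≤ y i → spread m y c + 1 ≡ spread m x c
  spread-raise-above c≤yi = sumTo-incr _ _ i m i≤m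
    (λ k k≤ k≢i → cong (λ t → ∣ t - c ∣) (sym (elsewhere k k≤ k≢i)))
    (trans (∣m-n∣+1≡∣1+m-n∣ c≤yi) (cong (λ t → ∣ t - c ∣) (sym at-i)))

  spread-raise-below : x i ≤ c → spread m x c + 1 ≡ spread m y c
  spread-raise-below xi≤c = sumTo-incr _ _ i m i≤m
    (λ k k≤ k≢i → cong (λ t → ∣ t - c ∣) (elsewhere k k≤ k≢i))
    (trans (cong (λ t → ∣ t - c ∣ + 1) at-i) (∣1+m-n∣+1≡∣m-n∣ (subst (_≤ c) at-i xi≤c)))

PrefixStep⇒spread-drop-forward : ∀ n m Pu Pv i w → i ≤ m → PrefixStep n m Pu Pv i w →
  ∀ q → q * n < Pu i → spread m Pv ((q + w) * n) + 1 ≡ spread m Pu (q * n)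
PrefixStep⇒spread-drop-forward n m Pu Pv i w i≤m shift q qn<Pui = begin
  spread m Pv ((q + w) * n) + 1      ≡⟨ spread-raise-above m x Pv i _ i≤m (λ k k≤ → shift k k≤) c≤Pvi ⟩
  spread m x ((q + w) * n)           ≡⟨ cong (spread m x) ([q+w]*n≡q*n+n*w n q w) ⟩
  spread m x (q * n + n * w)         ≡⟨ spread-+ m Pu (q * n) (n * w) ⟩
  spread m Pu (q * n)                ∎
  where
  open ≡-Reasoning
  x : ℕ → ℕ
  x k = Pu k + n * w
  c≤Pvi : (q + w) * n ≤ Pv i
  c≤Pvi = ≤-pred (subst₂ _≤_ (cong suc (sym ([q+w]*n≡q*n+n*w n q w)))
    (trans (shift i i≤m) (trans (cong (Pv i +_) (χ≡-refl i)) (+-comm (Pv i) 1)))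
    (+-monoˡ-≤ (n * w) qn<Pui))

PrefixStep⇒spread-drop-backward : ∀ n m Pu Pv i w → i ≤ m → PrefixStep n m Pu Pv i w →
  ∀ q → w ≤ q → Pv i < q * n → spread m Pu ((q ∸ w) * n) + 1 ≡ spread m Pv (q * n)
PrefixStep⇒spread-drop-backward n m Pu Pv i w i≤m shift q w≤q Pvi<qn = begin
  spread m Pu ((q ∸ w) * n) + 1          ≡⟨ cong (_+ 1) (sym (spread-+ m Pu _ (n * w))) ⟩
  spread m x ((q ∸ w) * n + n * w) + 1   ≡⟨ cong (λ t → spread m x t + 1) (trans (sym ([q+w]*n≡q*n+n*w n (q ∸ w) w)) (cong (_* n) (m∸n+n≡m w≤q))) ⟩
  spread m x (q * n) + 1                 ≡⟨ spread-raise-below m x Pv i _ i≤m (λ k k≤ → shift k k≤) xi≤qn ⟩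
  spread m Pv (q * n)                    ∎
  where
  open ≡-Reasoning
  x : ℕ → ℕ
  x k = Pu k + n * w
  xi≤qn : x i ≤ q * n
  xi≤qn = subst (_≤ q * n) (sym (trans (shift i i≤m) (trans (cong (Pv i +_) (χ≡-refl i)) (+-comm (Pv i) 1)))) Pvi<qn

∣-transfer : ∀ {n a b w w′} → a + n * w ≡ b + n * w′ → n ∣ a → n ∣ b
∣-transfer {n} {a} {b} {w} {w′} e n∣a =
  ∣m+n∣m⇒∣n (subst (n ∣_) (trans e (+-comm b (n * w′))) (∣m∣n⇒∣m+n n∣a (m∣m*n w))) (m∣m*n w′)

spread-flat : ∀ m (x : ℕ → ℕ) c → (∀ k → k ≤ m → x k ≡ c) → spread m x c ≡ 0
spread-flat m x c x≡c = sumTo-zeros _ m (λ k k≤ → m≡n⇒∣m-n∣≡0 (x≡c k k≤))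

first<level : ∀ m (g : ℕ → ℕ) c → sumTo g m ≤ c → 0 < spread m (sumTo g) c → sumTo g 0 < c
first<level m g c Pm≤c spread>0 with c ≤? sumTo g 0
... | no c≰P0 = ≰⇒> c≰P0
... | yes c≤P0 = ⊥-elim (<-irrefl (sym (spread-flat m (sumTo g) c level)) spread>0)
  where
  level : ∀ k → k ≤ m → sumTo g k ≡ c
  level k k≤m = ≤-antisym (≤-trans (sumTo-monoʳ-≤ g k≤m) Pm≤c) (≤-trans c≤P0 (sumTo-monoʳ-≤ g {0} {k} z≤n))

Descent : ℕ → (m : ℕ) → Coord m → ℕ → Set
Descent n m y q = Σ (Coord m) λ z → Valid n m z × Adj n m z y × Σ ℕ λ q′ → cost n m (at z) q′ + 1 ≡ cost n m (at y) q

descend-above : ∀ n m → 1 ≤ n → (y : Coord m) → Valid n m y → ∀ q → q * n < sumTo (at y) m → Descent n m y q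
descend-above n m 1≤n y valid q qn<Pm
  with movable-unit-above n m (at y) (Valid⇒ValidSeq n m y valid) (q * n) qn<Pm
... | i , i≤m , qn<Pi , full , empty
  with unit-down n m i (at y i) 1≤n (proj₁ (Valid⇒ValidSeq n m y valid) i (m≤n⇒m≤1+n i≤m)) full
     | unit-up n m (suc i) (at y (suc i)) 1≤n (proj₁ (Valid⇒ValidSeq n m y valid) (suc i) (s≤s i≤m)) empty
... | a , a-fits , a-succ | b , b-fits , b-succ
  with RightMove⇒UnitShift i≤m (modify-moveʳ y i a b i≤m n a-succ b-succ)
... | w , _ , _ , shift = z , z-valid , Adj-sym {u = y} {v = z} (RightMove⇒Adj n m y z i i≤m (modify-moveʳ y i a b i≤m n a-succ b-succ)) ,
  q + w , PrefixStep⇒spread-drop-forward n m _ _ i w i≤m (UnitShiftProperties.prefix-step shift) q qn<Pi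
  where
  z = modify m y i a b
  z-valid : Valid n m z
  z-valid = modify-valid y i a b i≤m n valid a-fits b-fits
    (∣-transfer (UnitShiftProperties.total shift i≤m) (proj₂ (Valid⇒ValidSeq n m y valid)))

descend-below : ∀ n m → 1 ≤ n → (y : Coord m) → Valid n m y → ∀ q → sumTo (at y) m ≤ q * n →
  0 < cost n m (at y) q → Descent n m y q
descend-below n m 1≤n y valid q Pm≤qn cost>0
  with movable-unit-below n m (at y) (Valid⇒ValidSeq n m y valid) (q * n) (first<level m (at y) (q * n) Pm≤qn cost>0)
... | i , i≤m , Pi<qn , empty , full
  with unit-up n m i (at y i) 1≤n (proj₁ (Valid⇒ValidSeq n m y valid) i (m≤n⇒m≤1+n i≤m)) empty
     | unit-down n m (suc i) (at y (suc i)) 1≤n (proj₁ (Valid⇒ValidSeq n m y valid) (suc i) (s≤s i≤m)) full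
... | a , a-fits , a-succ | b , b-fits , b-succ
  with RightMove⇒UnitShift i≤m (modify-moveˡ y i a b i≤m n a-succ b-succ)
... | w , _ , w≤1 , shift = z , z-valid , RightMove⇒Adj n m z y i i≤m (modify-moveˡ y i a b i≤m n a-succ b-succ) ,
  q ∸ w , PrefixStep⇒spread-drop-backward n m _ _ i w i≤m (UnitShiftProperties.prefix-step shift) q (≤-trans w≤1 1≤q) Pi<qn
  where
  z = modify m y i a b
  z-valid : Valid n m z
  z-valid = modify-valid y i a b i≤m n valid a-fits b-fits
    (∣-transfer (sym (UnitShiftProperties.total shift i≤m)) (proj₂ (Valid⇒ValidSeq n m y valid)))
  1≤q : 1 ≤ q
  1≤q = n≢0⇒n>0 (λ { refl → <⇒≱ Pi<qn z≤n })

descend : ∀ n m → 1 ≤ n → (y : Coord m) → Valid n m y → ∀ q → 0 < cost n m (at y) q → Descent n m y q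
descend n m 1≤n y valid q cost>0 with q * n <? sumTo (at y) m
... | yes qn<Pm = descend-above n m 1≤n y valid q qn<Pm
... | no qn≮Pm = descend-below n m 1≤n y valid q (≮⇒≥ qn≮Pm) cost>0

∣∧<⇒≡0 : ∀ {n x} → n ∣ x → x < n → x ≡ 0
∣∧<⇒≡0 {x = zero} _ _ = refl
∣∧<⇒≡0 {x = suc x} n∣x x<n = ⊥-elim (<⇒≱ x<n (∣⇒≤ n∣x))

cost≡0⇒𝟎 : ∀ n m (y : Coord m) → Valid n m y → ∀ q → cost n m (at y) q ≡ 0 → y ≡ 𝟎 m
cost≡0⇒𝟎 n m y valid q cost≡0 = at-ext y (𝟎 m) (λ k k< → trans (zero-at k (≤-pred k<)) (sym (at-replicate (suc (suc m)) k)))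
  where
  g = at y
  V = Valid⇒ValidSeq n m y valid
  level : ∀ k → k ≤ m → sumTo g k ≡ q * n
  level k k≤ = ∣m-n∣≡0⇒m≡n (n≤0⇒n≡0 (subst (∣ sumTo g k - q * n ∣ ≤_) cost≡0 (term≤sumTo (λ k → ∣ sumTo g k - q * n ∣) m k≤)))
  q≡0 : q ≡ 0
  q≡0 = n≤0⇒n≡0 (≮⇒≥ (λ 0<q → <⇒≱ (first<n V) (subst (n ≤_) (sym (level 0 z≤n)) (subst (_≤ q * n) (*-identityˡ n) (*-monoˡ-≤ n 0<q)))))
  level0 : ∀ k → k ≤ m → sumTo g k ≡ 0
  level0 k k≤ = trans (level k k≤) (cong (_* n) q≡0)
  zero-at : ∀ k → k ≤ suc m → g k ≡ 0
  zero-at k k≤ with k ≟ suc m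
  ... | yes refl = ∣∧<⇒≡0 (subst (n ∣_) (cong (_+ g (suc m)) (level0 m ≤-refl)) (proj₂ V)) (last<n V)
  ... | no k≢sm = n≤0⇒n≡0 (subst (g k ≤_) (level0 k (≤-pred (≤∧≢⇒< k≤ k≢sm))) (term≤sumTo g k ≤-refl))

Walk-snoc : ∀ {n m} {x z y : Coord m} {k} → Walk n m x z k → Valid n m z → Adj n m z y → Valid n m y → Walk n m x y (suc k)
Walk-snoc here vz adj vy = step vz adj vy here
Walk-snoc (step vx adj′ vx′ walk) vz adj vy = step vx adj′ vx′ (Walk-snoc walk vz adj vy)

Walk-from-𝟎 : ∀ n m → 1 ≤ n → ∀ (y : Coord m) q → Valid n m y →
  Σ ℕ λ L → L ≤ cost n m (at y) q × Walk n m (𝟎 m) y L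
Walk-from-𝟎 n m 1≤n y q valid = go (cost n m (at y) q) y q valid ≤-refl
  where
  go : ∀ c (y : Coord m) q → Valid n m y → cost n m (at y) q ≤ c → Σ ℕ λ L → L ≤ cost n m (at y) q × Walk n m (𝟎 m) y L
  go c y q valid c≤ with cost n m (at y) q ≟ 0
  ... | yes cost≡0 rewrite cost≡0⇒𝟎 n m y valid q cost≡0 = 0 , z≤n , here
  go zero y q valid c≤ | no cost≢0 = ⊥-elim (cost≢0 (n≤0⇒n≡0 c≤))
  go (suc c) y q valid c≤ | no cost≢0 with descend n m 1≤n y valid q (n≢0⇒n>0 cost≢0)
  ... | z , vz , adj , q′ , drop with go c z q′ vz (≤-pred (subst (_≤ suc c) (trans (sym drop) (+-comm _ 1)) c≤))
  ... | L , L≤ , walk = suc L , subst (suc L ≤_) (trans (+-comm 1 _) drop) (s≤s L≤) , Walk-snoc walk vz adj valid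

argmin : (f : ℕ → ℕ) → ∀ N → Σ ℕ λ q → q ≤ N × (∀ q′ → q′ ≤ N → f q ≤ f q′)
argmin f zero = 0 , z≤n , λ { q′ z≤n → ≤-refl }
argmin f (suc N) with argmin f N
... | q , q≤N , min with f q ≤? f (suc N)
... | yes fq≤ = q , m≤n⇒m≤1+n q≤N , min′
  where
  min′ : ∀ q′ → q′ ≤ suc N → f q ≤ f q′
  min′ q′ q′≤ with q′ ≟ suc N
  ... | yes refl = fq≤
  ... | no q′≢ = min q′ (≤-pred (≤∧≢⇒< q′≤ q′≢))
... | no fq≰ = suc N , ≤-refl , min′
  where
  min′ : ∀ q′ → q′ ≤ suc N → f (suc N) ≤ f q′
  min′ q′ q′≤ with q′ ≟ suc N
  ... | yes refl = ≤-refl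
  ... | no q′≢ = ≤-trans (<⇒≤ (≰⇒> fq≰)) (min q′ (≤-pred (≤∧≢⇒< q′≤ q′≢)))

-- Beyond the total prefix sum every point is below the level q n, so cost grows with q.
cost-mono-beyond : ∀ n m (g : ℕ → ℕ) → 1 ≤ n → ∀ d → cost n m g (sumTo g m) ≤ cost n m g (sumTo g m + d)
cost-mono-beyond n m g 1≤n zero = ≤-reflexive (cong (cost n m g) (sym (+-identityʳ (sumTo g m))))
cost-mono-beyond n m g 1≤n (suc d) = ≤-trans (cost-mono-beyond n m g 1≤n d)
  (subst (λ t → cost n m g (sumTo g m + d) ≤ cost n m g t) (sym (+-suc (sumTo g m) d)) (sumTo-mono-≤ m pointwise))
  where
  q = sumTo g m + d
  pointwise : ∀ k → k ≤ m → ∣ sumTo g k - q * n ∣ ≤ ∣ sumTo g k - suc q * n ∣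
  pointwise k k≤ = subst₂ _≤_ (sym (m≤n⇒∣m-n∣≡n∸m below)) (sym (m≤n⇒∣m-n∣≡n∸m (≤-trans below (m≤n+m (q * n) n))))
    (∸-monoˡ-≤ (sumTo g k) (m≤n+m (q * n) n))
    where
    below : sumTo g k ≤ q * n
    below = ≤-trans (sumTo-monoʳ-≤ g k≤) (≤-trans (m≤m+n _ d) (subst (_≤ q * n) (*-identityʳ q) (*-monoʳ-≤ q 1≤n)))

cost-minimiser : ∀ n m (g : ℕ → ℕ) → 1 ≤ n → Σ ℕ λ q → ∀ q′ → cost n m g q ≤ cost n m g q′
cost-minimiser n m g 1≤n with argmin (cost n m g) (sumTo g m)
... | q , _ , min = q , min′
  where
  min′ : ∀ q′ → cost n m g q ≤ cost n m g q′
  min′ q′ with q′ ≤? sumTo g m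
  ... | yes q′≤ = min q′ q′≤
  ... | no q′≰ with m≤n⇒∃[o]m+o≡n (<⇒≤ (≰⇒> q′≰))
  ... | d , refl = ≤-trans (min (sumTo g m) ≤-refl) (cost-mono-beyond n m g 1≤n d)

cost-𝟎 : ∀ n m → cost n m (at (𝟎 m)) 0 ≡ 0
cost-𝟎 n m = spread-flat m _ 0 (λ k _ → prefix k)
  where
  prefix : ∀ k → sumTo (at (𝟎 m)) k ≡ 0
  prefix zero = at-replicate (suc (suc m)) 0
  prefix (suc k) = cong₂ _+_ (prefix k) (at-replicate (suc (suc m)) (suc k))

Walk-from-𝟎⇒cost-≤ : ∀ n m (y : Coord m) {k} → Walk n m (𝟎 m) y k → Σ ℕ λ q → cost n m (at y) q ≤ k
Walk-from-𝟎⇒cost-≤ n m y walk with Walk⇒cost-≤ n m walk 0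
... | q , c≤ = q , subst (λ t → cost n m (at y) q ≤ t + _) (cost-𝟎 n m) c≤

distance-from-𝟎 : ∀ n m → 1 ≤ n → ∀ y → Valid n m y → Σ ℕ λ d → (∀ q → d ≤ cost n m (at y) q) × IsDist n m (𝟎 m) y d
distance-from-𝟎 n m 1≤n y valid with cost-minimiser n m (at y) 1≤n
... | q , min with Walk-from-𝟎 n m 1≤n y q valid
... | L , L≤ , walk = L , (λ q′ → ≤-trans L≤ (min q′)) , walk , shorter
  where
  shorter : ∀ k → k < L → ¬ Walk n m (𝟎 m) y k
  shorter k k<L walk′ with Walk-from-𝟎⇒cost-≤ n m y walk′
  ... | q′ , c≤k = <-irrefl refl (≤-trans k<L (≤-trans L≤ (≤-trans (min q′) c≤k)))

FarVertex : ℕ → (m : ℕ) → ℕ → Set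
FarVertex n m E = Σ (Coord m) λ y → Valid n m y × (∀ q → E ≤ cost n m (at y) q)

ecc-from-cost : ∀ n m E → 1 ≤ n → (∀ y → Valid n m y → Σ ℕ λ q → cost n m (at y) q ≤ E) → FarVertex n m E →
  IsEcc n m (𝟎 m) E
ecc-from-cost n m E 1≤n upper (y₀ , valid₀ , lower) = within , attained
  where
  within : ∀ y → Valid n m y → Σ ℕ λ d → d ≤ E × IsDist n m (𝟎 m) y d
  within y valid with distance-from-𝟎 n m 1≤n y valid | upper y valid
  ... | d , d≤cost , isDist | q , c≤E = d , ≤-trans (d≤cost q) c≤E , isDist
  attained : Σ (Coord m) λ y → Valid n m y × IsDist n m (𝟎 m) y E
  attained with distance-from-𝟎 n m 1≤n y₀ valid₀ | upper y₀ valid₀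
  ... | d , d≤cost , walk , shorter | q , c≤E = y₀ , valid₀ , subst (Walk n m (𝟎 m) y₀) d≡E walk ,
        λ k k<E → shorter k (subst (k <_) (sym d≡E) k<E)
    where
    d≡E : d ≡ E
    d≡E = ≤-antisym (≤-trans (d≤cost q) c≤E)
      (let (q′ , c≤d) = Walk-from-𝟎⇒cost-≤ n m y₀ walk in ≤-trans (lower q′) c≤d)

-- Spreads of staircases

Staircase : ℕ → (ℕ → ℕ) → Set
Staircase m x = ∀ k → k < m → x k ≤ x (suc k) × x (suc k) ≤ suc (x k)

Staircase-pred : ∀ m x → Staircase (suc m) x → Staircase m x
Staircase-pred m x s k k<m = s k (<-trans k<m (n<1+n m))

Staircase-mono : ∀ m x → Staircase m x → ∀ {i j} → i ≤ j → j ≤ m → x i ≤ x j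
Staircase-mono m x s {i} i≤j j≤m with m≤n⇒∃[o]m+o≡n i≤j
... | d , refl = go d j≤m
  where
  go : ∀ d → i + d ≤ m → x i ≤ x (i + d)
  go zero _ rewrite +-identityʳ i = ≤-refl
  go (suc d) i+d<m rewrite +-suc i d = ≤-trans (go d (<⇒≤ i+d<m)) (proj₁ (s (i + d) i+d<m))

Staircase-sumTo : ∀ m (b : ℕ → ℕ) → (∀ k → 1 ≤ k → k ≤ m → b k ≤ 1) → Staircase m (sumTo b)
Staircase-sumTo m b bits k k<m = m≤m+n _ _ ,
  subst (sumTo b k + b (suc k) ≤_) (+-comm (sumTo b k) 1) (+-monoʳ-≤ (sumTo b k) (bits (suc k) (s≤s z≤n) k<m))

#below : ℕ → (ℕ → ℕ) → ℕ → ℕ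
#below m x c = sumTo (λ k → χ< (x k) c) m

#above : ℕ → (ℕ → ℕ) → ℕ → ℕ
#above m x c = sumTo (λ k → χ< c (x k)) m

deficit : ℕ → (ℕ → ℕ) → ℕ → ℕ
deficit m x c = sumTo (λ k → c ∸ x k) m

excess : ℕ → (ℕ → ℕ) → ℕ → ℕ
excess m x c = sumTo (λ k → x k ∸ c) m

∣m-n∣≡[n∸m]+[m∸n] : ∀ m n → ∣ m - n ∣ ≡ (n ∸ m) + (m ∸ n)
∣m-n∣≡[n∸m]+[m∸n] m n with ≤-total m n
... | inj₁ m≤n = trans (m≤n⇒∣m-n∣≡n∸m m≤n) (sym (trans (cong ((n ∸ m) +_) (m≤n⇒m∸n≡0 m≤n)) (+-identityʳ _)))
... | inj₂ n≤m = trans (m≤n⇒∣n-m∣≡n∸m n≤m) (sym (cong (_+ (m ∸ n)) (m≤n⇒m∸n≡0 n≤m)))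

spread≡deficit+excess : ∀ m x c → spread m x c ≡ deficit m x c + excess m x c
spread≡deficit+excess m x c =
  trans (sumTo-cong m (λ k _ → ∣m-n∣≡[n∸m]+[m∸n] (x k) c)) (sumTo-+ (λ k → c ∸ x k) (λ k → x k ∸ c) m)

#below+#above≤ : ∀ m x c → #below m x c + #above m x c ≤ suc m
#below+#above≤ m x c = subst (_≤ suc m) (sumTo-+ _ _ m) (sumTo-bits-≤ _ m (λ k _ → χ<-asym (x k) c))

-- A level within the range of the staircase is attained, so it is neither below nor above that point.
#below+#above≤m : ∀ m x c → Staircase m x → x 0 ≤ c → c ≤ x m → #below m x c + #above m x c ≤ m
#below+#above≤m zero x c _ x0≤c c≤x0 with ≤-antisym x0≤c c≤x0
... | refl = ≤-reflexive (cong₂ _+_ (χ<-no (≤-refl {x 0})) (χ<-no (≤-refl {x 0})))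
#below+#above≤m (suc m) x c s x0≤c c≤xsm with c ≤? x m
... | yes c≤xm = subst (_≤ suc m) (interchange (#below m x c) (#above m x c) _ _)
  (≤-trans (+-mono-≤ (#below+#above≤m m x c (Staircase-pred m x s) x0≤c c≤xm) (χ<-asym (x (suc m)) c)) (≤-reflexive (+-comm m 1)))
... | no c≰xm = subst (_≤ suc m) (interchange (#below m x c) (#above m x c) _ _)
  (subst (#below m x c + #above m x c + (χ< (x (suc m)) c + χ< c (x (suc m))) ≤_) (+-identityʳ (suc m))
    (+-mono-≤ (#below+#above≤ m x c) (≤-reflexive (cong₂ _+_ (χ<-no (≤-reflexive c≡)) (χ<-no (≤-reflexive (sym c≡)))))))
  where
  c≡ : c ≡ x (suc m)
  c≡ = ≤-antisym c≤xsm (≤-trans (proj₂ (s m ≤-refl)) (≰⇒> c≰xm))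

-- Above the level c the staircase climbs by at most one per point, so the excesses
-- are bounded by 1, 2, …, #above.
excess-≤ : ∀ m x c → Staircase m x → x 0 ≤ c → excess m x c ≤ tri (#above m x c)
excess-≤ m x c s x0≤c = proj₁ (go m s)
  where
  go : ∀ m → Staircase m x → excess m x c ≤ tri (#above m x c) × (x m ∸ c ≤ #above m x c)
  go zero _ = ≤-trans (≤-reflexive (m≤n⇒m∸n≡0 x0≤c)) z≤n , ≤-trans (≤-reflexive (m≤n⇒m∸n≡0 x0≤c)) z≤n
  go (suc m) s with go m (Staircase-pred m x s) | c <? x (suc m)
  ... | sum≤ , top≤ | yes c<x rewrite χ<-yes c<x = sum≤′ , top≤′
    where
    D = #above m x c
    top≤′ : x (suc m) ∸ c ≤ D + 1
    top≤′ = m≤n+o⇒m∸n≤o (x (suc m)) c (begin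
      x (suc m)             ≤⟨ proj₂ (s m ≤-refl) ⟩
      suc (x m)             ≤⟨ s≤s (m≤n+m∸n (x m) c) ⟩
      suc (c + (x m ∸ c))   ≤⟨ s≤s (+-monoʳ-≤ c top≤) ⟩
      suc (c + D)           ≡⟨ sym (+-suc c D) ⟩
      c + suc D             ≡⟨ cong (c +_) (+-comm 1 D) ⟩
      c + (D + 1)           ∎)
      where open ≤-Reasoning
    sum≤′ : excess m x c + (x (suc m) ∸ c) ≤ tri (D + 1)
    sum≤′ = begin
      excess m x c + (x (suc m) ∸ c) ≤⟨ +-mono-≤ sum≤ top≤′ ⟩
      tri D + (D + 1)                ≡⟨ cong (λ t → tri D + t) (+-comm D 1) ⟩
      tri D + suc D                  ≡⟨ cong tri (+-comm 1 D) ⟩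
      tri (D + 1)                    ∎
      where open ≤-Reasoning
  ... | sum≤ , _ | no c≮x rewrite χ<-no {c} {x (suc m)} (≮⇒≥ c≮x) | m≤n⇒m∸n≡0 (≮⇒≥ c≮x)
                                | +-identityʳ (excess m x c) | +-identityʳ (#above m x c) = sum≤ , z≤n

deficit-≤ : ∀ m x c → Staircase m x → c ≤ x m → deficit m x c ≤ tri (#below m x c)
deficit-≤ m x c s c≤xm = subst (deficit m x c ≤_) (trans (cong (λ t → tri (#below m x c) + #below m x c * t)
    (m≤n⇒m∸n≡0 (m≤n⇒m≤1+n c≤xm))) (trans (cong (tri (#below m x c) +_) (*-zeroʳ (#below m x c))) (+-identityʳ _)))
  (go m s)
  where
  -- the general invariant, where the last point may still lie below c
  go : ∀ m → Staircase m x → deficit m x c ≤ tri (#below m x c) + #below m x c * (c ∸ suc (x m))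
  go zero _ with x 0 <? c
  ... | yes x0<c rewrite χ<-yes x0<c = ≤-reflexive (sym (trans (cong suc (+-identityʳ (c ∸ suc (x 0)))) (sym (+-∸-assoc 1 x0<c))))
  ... | no x0≮c rewrite χ<-no {x 0} {c} (≮⇒≥ x0≮c) | m≤n⇒m∸n≡0 (≮⇒≥ x0≮c) = z≤n
  go (suc m) s with go m (Staircase-pred m x s) | x (suc m) <? c
  ... | sum≤ | yes x<c rewrite χ<-yes x<c = begin
    deficit m x c + (c ∸ x′)                    ≤⟨ +-monoˡ-≤ (c ∸ x′) sum≤ ⟩
    tri G + G * (c ∸ suc (x m)) + (c ∸ x′)      ≤⟨ +-monoˡ-≤ (c ∸ x′) (+-monoʳ-≤ (tri G) (*-monoʳ-≤ G (∸-monoʳ-≤ c (proj₂ (s m ≤-refl))))) ⟩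
    tri G + G * (c ∸ x′) + (c ∸ x′)             ≡⟨ cong (λ t → tri G + G * t + t) (+-∸-assoc 1 x<c) ⟩
    tri G + G * suc d + suc d                   ≡⟨ rearrange (tri G) G d ⟩
    tri G + suc G + suc G * d                   ≡⟨ cong₂ (λ a b → tri a + b * d) (+-comm 1 G) (+-comm 1 G) ⟩
    tri (G + 1) + (G + 1) * d                   ∎
    where
    open ≤-Reasoning
    G = #below m x c
    x′ = x (suc m)
    d = c ∸ suc x′
    rearrange : ∀ t g d → t + g * suc d + suc d ≡ t + suc g + suc g * d
    rearrange = solve-∀
  ... | sum≤ | no x≮c rewrite χ<-no {x (suc m)} {c} (≮⇒≥ x≮c) | m≤n⇒m∸n≡0 (≮⇒≥ x≮c)
                           | +-identityʳ (#below m x c) | +-identityʳ (deficit m x c) =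
    ≤-trans sum≤ (≤-reflexive (cong (λ t → tri (#below m x c) + #below m x c * t)
      (trans (m≤n⇒m∸n≡0 (≤-trans (≮⇒≥ x≮c) (proj₂ (s m ≤-refl)))) (sym (m≤n⇒m∸n≡0 (≤-trans (≮⇒≥ x≮c) (n≤1+n _)))))))

spread-≤-tri : ∀ m x c → Staircase m x → x 0 ≤ c → c ≤ x m → spread m x c ≤ tri (#below m x c) + tri (#above m x c)
spread-≤-tri m x c s x0≤c c≤xm = subst (_≤ tri (#below m x c) + tri (#above m x c)) (sym (spread≡deficit+excess m x c))
  (+-mono-≤ (deficit-≤ m x c s c≤xm) (excess-≤ m x c s x0≤c))

∣m+n-m∣≡n : ∀ m n → ∣ m + n - m ∣ ≡ n
∣m+n-m∣≡n m n = trans (∣-∣-comm (m + n) m) (∣m-m+n∣≡n m n)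

∣c+s-c∣+∣c+s-[n+c]∣ : ∀ c s n → ∣ c + s - c ∣ + ∣ c + s - (n + c) ∣ ≡ n + 2 * (c ∸ (c + s)) + 2 * (c + s ∸ (n + c))
∣c+s-c∣+∣c+s-[n+c]∣ c s n with ≤-total s n
... | inj₁ s≤n with m≤n⇒∃[o]m+o≡n s≤n
...   | u , refl = begin
  ∣ c + s - c ∣ + ∣ c + s - s + u + c ∣ ≡⟨ cong₂ _+_ (∣m+n-m∣≡n c s) (trans (cong (λ z → ∣ c + s - z ∣) (rotate s u c)) (∣m-m+n∣≡n (c + s) u)) ⟩
  s + u                                 ≡⟨ rearrange s u ⟩
  s + u + 2 * 0 + 2 * 0                 ≡⟨ cong₂ (λ p q → s + u + 2 * p + 2 * q) (sym (m≤n⇒m∸n≡0 (m≤m+n c s)))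
                                            (sym (m≤n⇒m∸n≡0 (subst (c + s ≤_) (sym (rotate s u c)) (m≤m+n (c + s) u)))) ⟩
  s + u + 2 * (c ∸ (c + s)) + 2 * (c + s ∸ (s + u + c)) ∎
  where
  open ≡-Reasoning
  rotate : ∀ s u c → s + u + c ≡ c + s + u
  rotate = solve-∀
  rearrange : ∀ s u → s + u ≡ s + u + 2 * 0 + 2 * 0
  rearrange = solve-∀
∣c+s-c∣+∣c+s-[n+c]∣ c s n | inj₂ n≤s with m≤n⇒∃[o]m+o≡n n≤s
... | v , refl = begin
  ∣ c + (n + v) - c ∣ + ∣ c + (n + v) - n + c ∣ ≡⟨ cong₂ _+_ (∣m+n-m∣≡n c (n + v)) (trans (cong (λ z → ∣ z - n + c ∣) (rotate c n v)) (∣m+n-m∣≡n (n + c) v)) ⟩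
  n + v + v                                     ≡⟨ rearrange n v ⟩
  n + 2 * 0 + 2 * v                             ≡⟨ cong₂ (λ p q → n + 2 * p + 2 * q) (sym (m≤n⇒m∸n≡0 (m≤m+n c (n + v))))
                                                     (sym (trans (cong (_∸ (n + c)) (rotate c n v)) (m+n∸m≡n (n + c) v))) ⟩
  n + 2 * (c ∸ (c + (n + v))) + 2 * (c + (n + v) ∸ (n + c)) ∎
  where
  open ≡-Reasoning
  rotate : ∀ c n v → c + (n + v) ≡ n + c + v
  rotate = solve-∀
  rearrange : ∀ n v → n + v + v ≡ n + 2 * 0 + 2 * v
  rearrange = solve-∀

∣a-c∣+∣a-[n+c]∣ : ∀ a c n → ∣ a - c ∣ + ∣ a - (n + c) ∣ ≡ n + 2 * (c ∸ a) + 2 * (a ∸ (n + c))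
∣a-c∣+∣a-[n+c]∣ a c n with ≤-total a c
... | inj₁ a≤c with m≤n⇒∃[o]m+o≡n a≤c
...   | t , refl = begin
  ∣ a - a + t ∣ + ∣ a - n + (a + t) ∣ ≡⟨ cong₂ _+_ (∣m-m+n∣≡n a t) (trans (cong (λ z → ∣ a - z ∣) (x∙yz≈y∙xz n a t)) (∣m-m+n∣≡n a (n + t))) ⟩
  t + (n + t)                         ≡⟨ rearrange n t ⟩
  n + 2 * t + 2 * 0                   ≡⟨ cong₂ (λ u v → n + 2 * u + 2 * v) (sym (m+n∸m≡n a t)) (sym (m≤n⇒m∸n≡0 (≤-trans (m≤m+n a t) (m≤n+m (a + t) n)))) ⟩
  n + 2 * (a + t ∸ a) + 2 * (a ∸ (n + (a + t))) ∎
  where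
  open ≡-Reasoning
  rearrange : ∀ n t → t + (n + t) ≡ n + 2 * t + 2 * 0
  rearrange = solve-∀
∣a-c∣+∣a-[n+c]∣ a c n | inj₂ c≤a with m≤n⇒∃[o]m+o≡n c≤a
... | s , refl = ∣c+s-c∣+∣c+s-[n+c]∣ c s n

-- Every point contributes exactly n to the two spreads, plus twice its overshoot outside [c, n + c].
spread+spread : ∀ m x c n → spread m x c + spread m x (n + c) ≡ suc m * n + 2 * deficit m x c + 2 * excess m x (n + c)
spread+spread m x c n = begin
  spread m x c + spread m x (n + c)                                          ≡⟨ sym (sumTo-+ _ _ m) ⟩
  sumTo (λ k → ∣ x k - c ∣ + ∣ x k - (n + c) ∣) m                             ≡⟨ sumTo-cong m (λ k _ → ∣a-c∣+∣a-[n+c]∣ (x k) c n) ⟩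
  sumTo (λ k → n + 2 * (c ∸ x k) + 2 * (x k ∸ (n + c))) m                     ≡⟨ sumTo-+ _ _ m ⟩
  sumTo (λ k → n + 2 * (c ∸ x k)) m + sumTo (λ k → 2 * (x k ∸ (n + c))) m     ≡⟨ cong₂ _+_ (sumTo-+ _ _ m) (sumTo-*ˡ 2 _ m) ⟩
  sumTo (λ _ → n) m + sumTo (λ k → 2 * (c ∸ x k)) m + 2 * excess m x (n + c)  ≡⟨ cong₂ (λ p q → p + q + 2 * excess m x (n + c)) (sumTo-const n m) (sumTo-*ˡ 2 _ m) ⟩
  suc m * n + 2 * deficit m x c + 2 * excess m x (n + c)                     ∎
  where open ≡-Reasoning

#below-none : ∀ m x c → (∀ k → k ≤ m → c ≤ x k) → #below m x c ≡ 0
#below-none m x c c≤ = sumTo-zeros _ m (λ k k≤ → χ<-no (c≤ k k≤))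

#above-none : ∀ m x c → (∀ k → k ≤ m → x k ≤ c) → #above m x c ≡ 0
#above-none m x c ≤c = sumTo-zeros _ m (λ k k≤ → χ<-no (≤c k k≤))

#below-all : ∀ m x c → (∀ k → k ≤ m → x k < c) → #below m x c ≡ suc m
#below-all m x c <c = trans (sumTo-cong m (λ k k≤ → χ<-yes (<c k k≤))) (trans (sumTo-const 1 m) (*-identityʳ (suc m)))

⌊m+[n+n]/2⌋≡⌊m/2⌋+n : ∀ m n → ⌊ m + (n + n) /2⌋ ≡ ⌊ m /2⌋ + n
⌊m+[n+n]/2⌋≡⌊m/2⌋+n m zero = trans (cong ⌊_/2⌋ (+-identityʳ m)) (sym (+-identityʳ _))
⌊m+[n+n]/2⌋≡⌊m/2⌋+n m (suc n) = begin
  ⌊ m + (suc n + suc n) /2⌋     ≡⟨ cong ⌊_/2⌋ (trans (+-suc m (n + suc n)) (cong suc (trans (cong (m +_) (+-suc n n)) (+-suc m (n + n))))) ⟩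
  ⌊ suc (suc (m + (n + n))) /2⌋ ≡⟨ cong suc (⌊m+[n+n]/2⌋≡⌊m/2⌋+n m n) ⟩
  suc (⌊ m /2⌋ + n)             ≡⟨ sym (+-suc _ n) ⟩
  ⌊ m /2⌋ + suc n               ∎
  where open ≡-Reasoning

2*m≤n⇒m≤⌊n/2⌋ : ∀ {m n} → 2 * m ≤ n → m ≤ ⌊ n /2⌋
2*m≤n⇒m≤⌊n/2⌋ {m} {n} 2m≤n = subst (_≤ ⌊ n /2⌋) (sym (n≡⌊n+n/2⌋ m))
  (⌊n/2⌋-mono (subst (_≤ n) (cong (m +_) (+-identityʳ m)) 2m≤n))

one-of-two-≤-half : ∀ a b S → a + b ≤ S → a ≤ ⌊ S /2⌋ ⊎ b ≤ ⌊ S /2⌋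
one-of-two-≤-half a b S a+b≤S with a ≤? b
... | yes a≤b = inj₁ (2*m≤n⇒m≤⌊n/2⌋ (≤-trans (+-monoʳ-≤ a (≤-trans (≤-reflexive (+-identityʳ a)) a≤b)) a+b≤S))
... | no a≰b = inj₂ (2*m≤n⇒m≤⌊n/2⌋ (≤-trans (subst (_≤ a + b) (sym (cong (b +_) (+-identityʳ b))) (+-monoˡ-≤ b (<⇒≤ (≰⇒> a≰b)))) a+b≤S))

crossing : (Q : ℕ → Set) → (∀ k → Dec (Q k)) → Q 0 → ∀ N → ¬ Q N → Σ ℕ λ q → Q q × ¬ Q (suc q)
crossing Q Q? q0 zero ¬qN = ⊥-elim (¬qN q0)
crossing Q Q? q0 (suc N) ¬qN with Q? N
... | yes qN = N , qN , ¬qN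
... | no ¬qN′ = crossing Q Q? q0 N ¬qN′

#below-beyond-top : ∀ m x c → Staircase m x → x m < c → #below m x c ≡ suc m
#below-beyond-top m x c s xm<c = #below-all m x c (λ k k≤ → ≤-<-trans (Staircase-mono m x s k≤ ≤-refl) xm<c)

spread-≤-central : ∀ m x c A E → Staircase m x →
  (∀ g d → A ≤ g → g ≤ m ∸ A → g + d ≤ m → tri g + tri d ≤ E) →
  x 0 ≤ c → c ≤ x m → A ≤ #below m x c → #below m x c ≤ m ∸ A → spread m x c ≤ E
spread-≤-central m x c A E s central x0≤c c≤xm A≤ ≤m∸A =
  ≤-trans (spread-≤-tri m x c s x0≤c c≤xm) (central _ _ A≤ ≤m∸A (#below+#above≤m m x c s x0≤c c≤xm))

central-or-few-below : ∀ m x c A → Staircase m x → (x 0 ≤ c × A ≤ #below m x c) ⊎ tri (#below m x c) ≤ tri (A ∸ 1)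
central-or-few-below m x c A s with x 0 ≤? c | A ≤? #below m x c
... | yes x0≤c | yes A≤ = inj₁ (x0≤c , A≤)
... | no x0≰c | _ = inj₂ (≤-trans (≤-reflexive (cong tri (#below-none m x c (λ k k≤ →
        ≤-trans (<⇒≤ (≰⇒> x0≰c)) (Staircase-mono m x s z≤n k≤))))) z≤n)
... | yes _ | no A≰ = inj₂ (tri-mono-≤ (<⇒≤pred (≰⇒> A≰)))

central-or-few-above : ∀ m x c A → Staircase m x → x 0 ≤ c → A ≤ m →
  (c ≤ x m × #below m x c ≤ m ∸ A) ⊎ tri (#above m x c) ≤ tri (A ∸ 1)
central-or-few-above m x c A s x0≤c A≤m with c ≤? x m
... | no c≰xm = inj₂ (≤-trans (≤-reflexive (cong tri (#above-none m x c (λ k k≤ →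
        ≤-trans (Staircase-mono m x s k≤ ≤-refl) (<⇒≤ (≰⇒> c≰xm)))))) z≤n)
... | yes c≤xm with #below m x c ≤? m ∸ A
...   | yes ≤m∸A = inj₁ (c≤xm , ≤m∸A)
...   | no ≰m∸A = inj₂ (tri-mono-≤ (<⇒≤pred (+-cancelˡ-< (m ∸ A) _ A (begin-strict
        m ∸ A + #above m x c          <⟨ +-monoˡ-< _ (≰⇒> ≰m∸A) ⟩
        #below m x c + #above m x c   ≤⟨ #below+#above≤m m x c s x0≤c c≤xm ⟩
        m                             ≡⟨ sym (m∸n+n≡m A≤m) ⟩
        m ∸ A + A                     ∎))))
  where open ≤-Reasoning

spread-≤-pair : ∀ m x c n t → Staircase m x → c ≤ x m → x 0 ≤ n + c →
  tri (#below m x c) ≤ t → tri (#above m x (n + c)) ≤ t →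
  spread m x c ≤ ⌊ suc m * n /2⌋ + 2 * t ⊎ spread m x (n + c) ≤ ⌊ suc m * n /2⌋ + 2 * t
spread-≤-pair m x c n t s c≤xm x0≤c′ few-below few-above =
  subst (λ b → spread m x c ≤ b ⊎ spread m x (n + c) ≤ b) (⌊m+[n+n]/2⌋≡⌊m/2⌋+n (suc m * n) (2 * t))
    (one-of-two-≤-half (spread m x c) (spread m x (n + c)) _ (begin
      spread m x c + spread m x (n + c)                       ≡⟨ spread+spread m x c n ⟩
      suc m * n + 2 * deficit m x c + 2 * excess m x (n + c)   ≤⟨ +-mono-≤ (+-monoʳ-≤ (suc m * n)
                                                                    (*-monoʳ-≤ 2 (≤-trans (deficit-≤ m x c s c≤xm) few-below)))
                                                                    (*-monoʳ-≤ 2 (≤-trans (excess-≤ m x (n + c) s x0≤c′) few-above)) ⟩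
      suc m * n + 2 * t + 2 * t                               ≡⟨ +-assoc (suc m * n) _ _ ⟩
      suc m * n + (2 * t + 2 * t)                             ∎))
  where open ≤-Reasoning

-- Take consecutive multiples c = q n and c + n of n around which A points lie below.
-- Either one of them is a central level, where spread-≤-tri applies, or few points
-- lie below c and above c + n and one of the two spreads is at most half their sum.
spread-≤-at-some-multiple : ∀ n m x A E → 1 ≤ n → Staircase m x → x 0 < n → A ≤ m ∸ A →
  (∀ g d → A ≤ g → g ≤ m ∸ A → g + d ≤ m → tri g + tri d ≤ E) →
  ⌊ suc m * n /2⌋ + 2 * tri (A ∸ 1) ≤ E →
  Σ ℕ λ q → spread m x (q * n) ≤ E
spread-≤-at-some-multiple n m x A E 1≤n s x0<n A≤m∸A central pair-budget
  with crossing (λ q → #below m x (q * n) ≤ A) (λ q → #below m x (q * n) ≤? A)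
         (≤-trans (≤-reflexive (#below-none m x 0 (λ _ _ → z≤n))) z≤n) (suc (x m)) (top≰ (suc (x m) * n) top<)
  where
  top≰ : ∀ c → x m < c → ¬ (#below m x c ≤ A)
  top≰ c xm<c below≤A = <⇒≱ (s≤s (≤-trans A≤m∸A (m∸n≤m m A))) (subst (_≤ A) (#below-beyond-top m x c s xm<c) below≤A)
  top< : x m < suc (x m) * n
  top< = subst (_≤ suc (x m) * n) (*-identityʳ (suc (x m))) (*-monoʳ-≤ (suc (x m)) 1≤n)
... | q , below≤A , below′≰A = by-cases
  where
  c≤xm : q * n ≤ x m
  c≤xm = ≮⇒≥ (λ xm<c → <⇒≱ (s≤s (≤-trans A≤m∸A (m∸n≤m m A)))
    (subst (_≤ A) (#below-beyond-top m x (q * n) s xm<c) below≤A))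
  x0≤c′ : x 0 ≤ suc q * n
  x0≤c′ = ≤-trans (<⇒≤ x0<n) (m≤m+n n (q * n))
  by-cases : Σ ℕ λ q → spread m x (q * n) ≤ E
  by-cases with central-or-few-below m x (q * n) A s | central-or-few-above m x (suc q * n) A s x0≤c′ (≤-trans A≤m∸A (m∸n≤m m A))
  ... | inj₁ (x0≤c , A≤) | _ = q , spread-≤-central m x _ A E s central x0≤c c≤xm A≤ (≤-trans below≤A A≤m∸A)
  ... | inj₂ _ | inj₁ (c′≤xm , ≤m∸A) = suc q , spread-≤-central m x _ A E s central x0≤c′ c′≤xm (<⇒≤ (≰⇒> below′≰A)) ≤m∸A
  ... | inj₂ few-below | inj₂ few-above with spread-≤-pair m x (q * n) n (tri (A ∸ 1)) s c≤xm x0≤c′ few-below few-above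
  ...   | inj₁ spread≤ = q , ≤-trans spread≤ pair-budget
  ...   | inj₂ spread≤ = suc q , ≤-trans spread≤ pair-budget

spread-lowering-pointwise : ∀ a c₁ c → c ≤ c₁ → ∣ a - c₁ ∣ + (c₁ ∸ c) * (1 ∸ χ< a c₁) ≤ ∣ a - c ∣ + (c₁ ∸ c) * χ< a c₁
spread-lowering-pointwise a c₁ c c≤c₁ with a <? c₁
... | yes a<c₁ rewrite χ<-yes a<c₁ = begin
  ∣ a - c₁ ∣ + (c₁ ∸ c) * 0 ≡⟨ cong (∣ a - c₁ ∣ +_) (*-zeroʳ (c₁ ∸ c)) ⟩
  ∣ a - c₁ ∣ + 0            ≡⟨ +-identityʳ _ ⟩
  ∣ a - c₁ ∣                ≤⟨ ∣-∣-triangle a c c₁ ⟩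
  ∣ a - c ∣ + ∣ c - c₁ ∣    ≡⟨ cong (∣ a - c ∣ +_) (trans (m≤n⇒∣m-n∣≡n∸m c≤c₁) (sym (*-identityʳ _))) ⟩
  ∣ a - c ∣ + (c₁ ∸ c) * 1  ∎
  where open ≤-Reasoning
... | no a≮c₁ with m≤n⇒∃[o]m+o≡n c≤c₁ | m≤n⇒∃[o]m+o≡n (≮⇒≥ a≮c₁)
... | d , refl | e , refl rewrite χ<-no {c + d + e} {c + d} (m≤m+n (c + d) e) = ≤-reflexive (begin
  ∣ c + d + e - c + d ∣ + (c + d ∸ c) * (1 ∸ 0) ≡⟨ cong₂ _+_ (∣m+n-m∣≡n (c + d) e) (cong (_* 1) (m+n∸m≡n c d)) ⟩
  e + d * 1                                     ≡⟨ rearrange e d ⟩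
  d + e + d * 0                                 ≡⟨ cong₂ (λ u v → u + v * 0) (sym (∣m+n-m∣≡n c (d + e))) (sym (m+n∸m≡n c d)) ⟩
  ∣ c + (d + e) - c ∣ + (c + d ∸ c) * 0         ≡⟨ cong (λ u → ∣ u - c ∣ + (c + d ∸ c) * 0) (sym (+-assoc c d e)) ⟩
  ∣ c + d + e - c ∣ + (c + d ∸ c) * 0           ∎)
  where
  open ≡-Reasoning
  rearrange : ∀ e d → e + d * 1 ≡ d + e + d * 0
  rearrange = solve-∀

spread-raising-pointwise : ∀ a c₂ c → c₂ ≤ c → ∣ a - c₂ ∣ + (c ∸ c₂) * (1 ∸ χ< c₂ a) ≤ ∣ a - c ∣ + (c ∸ c₂) * χ< c₂ a
spread-raising-pointwise a c₂ c c₂≤c with c₂ <? a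
... | yes c₂<a rewrite χ<-yes c₂<a = begin
  ∣ a - c₂ ∣ + (c ∸ c₂) * 0 ≡⟨ cong (∣ a - c₂ ∣ +_) (*-zeroʳ (c ∸ c₂)) ⟩
  ∣ a - c₂ ∣ + 0            ≡⟨ +-identityʳ _ ⟩
  ∣ a - c₂ ∣                ≤⟨ ∣-∣-triangle a c c₂ ⟩
  ∣ a - c ∣ + ∣ c - c₂ ∣    ≡⟨ cong (∣ a - c ∣ +_) (trans (m≤n⇒∣n-m∣≡n∸m c₂≤c) (sym (*-identityʳ _))) ⟩
  ∣ a - c ∣ + (c ∸ c₂) * 1  ∎
  where open ≤-Reasoning
... | no c₂≮a with m≤n⇒∃[o]m+o≡n (≮⇒≥ c₂≮a) | m≤n⇒∃[o]m+o≡n c₂≤c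
... | e , refl | d , refl rewrite χ<-no {a + e} {a} (m≤m+n a e) = ≤-reflexive (begin
  ∣ a - a + e ∣ + (a + e + d ∸ (a + e)) * (1 ∸ 0) ≡⟨ cong₂ _+_ (∣m-m+n∣≡n a e) (cong (_* 1) (m+n∸m≡n (a + e) d)) ⟩
  e + d * 1                                       ≡⟨ rearrange e d ⟩
  e + d + d * 0                                   ≡⟨ cong₂ (λ u v → u + v * 0) (sym (trans (cong (λ t → ∣ a - t ∣) (+-assoc a e d)) (∣m-m+n∣≡n a (e + d)))) (sym (m+n∸m≡n (a + e) d)) ⟩
  ∣ a - a + e + d ∣ + (a + e + d ∸ (a + e)) * 0   ∎)
  where
  open ≡-Reasoning
  rearrange : ∀ e d → e + d * 1 ≡ e + d + d * 0
  rearrange = solve-∀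

-- Lowering the level from c₁ to c moves it away from every point not below c₁,
-- so it cannot help while those points are at least as many as the ones below.
spread-lowering-≥ : ∀ m x c₁ c → c ≤ c₁ → #below m x c₁ ≤ sumTo (λ k → 1 ∸ χ< (x k) c₁) m → spread m x c₁ ≤ spread m x c
spread-lowering-≥ m x c₁ c c≤c₁ minority = +-cancelʳ-≤ (d * G) _ _ (begin
  spread m x c₁ + d * G                                   ≡⟨ cong (spread m x c₁ +_) (sym (sumTo-*ˡ d _ m)) ⟩
  spread m x c₁ + sumTo (λ k → d * (1 ∸ χ< (x k) c₁)) m   ≡⟨ sym (sumTo-+ _ _ m) ⟩
  sumTo (λ k → ∣ x k - c₁ ∣ + d * (1 ∸ χ< (x k) c₁)) m    ≤⟨ sumTo-mono-≤ m (λ k _ → spread-lowering-pointwise (x k) c₁ c c≤c₁) ⟩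
  sumTo (λ k → ∣ x k - c ∣ + d * χ< (x k) c₁) m           ≡⟨ sumTo-+ _ _ m ⟩
  spread m x c + sumTo (λ k → d * χ< (x k) c₁) m          ≡⟨ cong (spread m x c +_) (sumTo-*ˡ d _ m) ⟩
  spread m x c + d * #below m x c₁                        ≤⟨ +-monoʳ-≤ (spread m x c) (*-monoʳ-≤ d minority) ⟩
  spread m x c + d * G                                    ∎)
  where
  open ≤-Reasoning
  d = c₁ ∸ c
  G = sumTo (λ k → 1 ∸ χ< (x k) c₁) m

spread-raising-≥ : ∀ m x c₂ c → c₂ ≤ c → #above m x c₂ ≤ sumTo (λ k → 1 ∸ χ< c₂ (x k)) m → spread m x c₂ ≤ spread m x c
spread-raising-≥ m x c₂ c c₂≤c minority = +-cancelʳ-≤ (d * G) _ _ (begin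
  spread m x c₂ + d * G                                   ≡⟨ cong (spread m x c₂ +_) (sym (sumTo-*ˡ d _ m)) ⟩
  spread m x c₂ + sumTo (λ k → d * (1 ∸ χ< c₂ (x k))) m   ≡⟨ sym (sumTo-+ _ _ m) ⟩
  sumTo (λ k → ∣ x k - c₂ ∣ + d * (1 ∸ χ< c₂ (x k))) m    ≤⟨ sumTo-mono-≤ m (λ k _ → spread-raising-pointwise (x k) c₂ c c₂≤c) ⟩
  sumTo (λ k → ∣ x k - c ∣ + d * χ< c₂ (x k)) m           ≡⟨ sumTo-+ _ _ m ⟩
  spread m x c + sumTo (λ k → d * χ< c₂ (x k)) m          ≡⟨ cong (spread m x c +_) (sumTo-*ˡ d _ m) ⟩
  spread m x c + d * #above m x c₂                        ≤⟨ +-monoʳ-≤ (spread m x c) (*-monoʳ-≤ d minority) ⟩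
  spread m x c + d * G                                    ∎)
  where
  open ≤-Reasoning
  d = c ∸ c₂
  G = sumTo (λ k → 1 ∸ χ< c₂ (x k)) m

spread-≤-lower-half : ∀ m x → Staircase m x → ∀ j → 2 * j ≤ suc m → ∀ c → c ≤ x j → spread m x (x j) ≤ spread m x c
spread-≤-lower-half m x s j 2j≤ c c≤ = spread-lowering-≥ m x (x j) c c≤
  (sumTo-bits-minority (λ k → χ< (x k) (x j)) m (λ k _ → χ<-≤1 (x k) (x j)) (≤-trans (*-monoʳ-≤ 2 below≤j) 2j≤))
  where
  below≤j : #below m x (x j) ≤ j
  below≤j = sumTo-bits-vanishing-from (λ k → χ< (x k) (x j)) m j (λ k _ → χ<-≤1 (x k) (x j))
    (λ k j≤k k≤m → χ<-no (Staircase-mono m x s j≤k k≤m))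

spread-≤-upper-half : ∀ m x → Staircase m x → ∀ j → j ≤ m → 2 * (m ∸ j) ≤ suc m → ∀ c → x j ≤ c → spread m x (x j) ≤ spread m x c
spread-≤-upper-half m x s j j≤m 2j≤ c ≤c = spread-raising-≥ m x (x j) c ≤c
  (sumTo-bits-minority (λ k → χ< (x j) (x k)) m (λ k _ → χ<-≤1 (x j) (x k)) (≤-trans (*-monoʳ-≤ 2 above≤) 2j≤))
  where
  above≤ : #above m x (x j) ≤ m ∸ j
  above≤ = sumTo-bits-vanishing-upto (λ k → χ< (x j) (x k)) m j (λ k _ → χ<-≤1 (x j) (x k))
    (λ k k≤j → χ<-no (Staircase-mono m x s k≤j j≤m))

spread-at-multiples-≥ : ∀ n m (x : ℕ → ℕ) E → Staircase m x → ∀ j₁ j₂ q₁ → j₂ ≤ m →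
  2 * j₁ ≤ suc m → 2 * (m ∸ j₂) ≤ suc m → x j₁ ≡ q₁ * n → x j₂ ≡ suc q₁ * n →
  E ≤ spread m x (x j₁) → E ≤ spread m x (x j₂) → ∀ q → E ≤ spread m x (q * n)
spread-at-multiples-≥ n m x E s j₁ j₂ q₁ j₂≤m low high x₁≡ x₂≡ E≤₁ E≤₂ q with q ≤? q₁
... | yes q≤q₁ = ≤-trans E≤₁ (spread-≤-lower-half m x s j₁ low (q * n) (subst (q * n ≤_) (sym x₁≡) (*-monoˡ-≤ n q≤q₁)))
... | no q≰q₁ = ≤-trans E≤₂ (spread-≤-upper-half m x s j₂ j₂≤m high (q * n) (subst (_≤ q * n) (sym x₂≡) (*-monoˡ-≤ n (≰⇒> q≰q₁))))

-- Far vertices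

-- the least r < n with n ∣ a + r (and 0 when n = 0)
toMultiple : ℕ → ℕ → ℕ
toMultiple zero a = 0
toMultiple (suc n) a = (suc n ∸ a % suc n) % suc n

toMultiple-< : ∀ n a → 1 ≤ n → toMultiple n a < n
toMultiple-< (suc n) a _ = m%n<n (suc n ∸ a % suc n) (suc n)

toMultiple-∣ : ∀ n a → 1 ≤ n → n ∣ a + toMultiple n a
toMultiple-∣ (suc n) a _ with a % suc n | m≡m%n+[m/n]*n a (suc n) | m%n<n a (suc n)
... | zero | a≡ | _ = divides (a / suc n) (trans (cong (a +_) (n%n≡0 (suc n))) (trans (+-identityʳ a) a≡))
... | suc r | a≡ | r<n = divides (suc (a / suc n)) (begin
    a + (suc n ∸ suc r) % suc n                    ≡⟨ cong (a +_) (m<n⇒m%n≡m (s≤s (m∸n≤m n r))) ⟩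
    a + (suc n ∸ suc r)                            ≡⟨ cong (_+ (suc n ∸ suc r)) a≡ ⟩
    suc r + a / suc n * suc n + (suc n ∸ suc r)    ≡⟨ xy∙z≈y∙xz (suc r) (a / suc n * suc n) (suc n ∸ suc r) ⟩
    a / suc n * suc n + (suc r + (suc n ∸ suc r))  ≡⟨ cong (a / suc n * suc n +_) (m+[n∸m]≡n (<⇒≤ r<n)) ⟩
    a / suc n * suc n + suc n                      ≡⟨ +-comm _ (suc n) ⟩
    suc (a / suc n) * suc n                        ∎)
  where open ≡-Reasoning

_◂_ : ℕ → (ℕ → ℕ) → ℕ → ℕ
(r ◂ b) zero = r
(r ◂ b) (suc k) = b (suc k)

closeUp : ℕ → ℕ → (ℕ → ℕ) → ℕ → ℕ
closeUp n m f k with k ≤? m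
... | yes _ = f k
... | no _ = toMultiple n (sumTo f m)

closeUp-≤ : ∀ n m f k → k ≤ m → closeUp n m f k ≡ f k
closeUp-≤ n m f k k≤m with k ≤? m
... | yes _ = refl
... | no k≰m = ⊥-elim (k≰m k≤m)

closeUp-last : ∀ n m f → closeUp n m f (suc m) ≡ toMultiple n (sumTo f m)
closeUp-last n m f with suc m ≤? m
... | yes sm≤m = ⊥-elim (<-irrefl refl sm≤m)
... | no _ = refl

closeUp-ValidSeq : ∀ n m r b → 1 ≤ n → r < n → (∀ k → 1 ≤ k → k ≤ m → b k ≤ 1) → ValidSeq n m (closeUp n m (r ◂ b))
closeUp-ValidSeq n m r b 1≤n r<n bits = ValidSeq-intro
  (subst (_< n) (sym (closeUp-≤ n m (r ◂ b) 0 z≤n)) r<n)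
  (subst (_< n) (sym (closeUp-last n m (r ◂ b))) (toMultiple-< n _ 1≤n))
  (λ { (suc k) (s≤s _) k≤m → subst (_≤ 1) (sym (closeUp-≤ n m (r ◂ b) (suc k) k≤m)) (bits (suc k) (s≤s z≤n) k≤m) })
  (subst (n ∣_) (sym (cong₂ _+_ (sumTo-cong m (λ k k≤ → closeUp-≤ n m (r ◂ b) k k≤)) (closeUp-last n m (r ◂ b)))) (toMultiple-∣ n _ 1≤n))

witness : ℕ → (m : ℕ) → ℕ → (ℕ → ℕ) → Coord m
witness n m r b = tabulateℕ (suc (suc m)) (closeUp n m (r ◂ b))

witness-valid : ∀ n m r b → 1 ≤ n → r < n → (∀ k → 1 ≤ k → k ≤ m → b k ≤ 1) → Valid n m (witness n m r b)
witness-valid n m r b 1≤n r<n bits = ValidSeq⇒Valid-tabulateℕ n m _ (closeUp-ValidSeq n m r b 1≤n r<n bits)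

witness-cost : ∀ n m r b q → cost n m (at (witness n m r b)) q ≡ spread m (sumTo (r ◂ b)) (q * n)
witness-cost n m r b q = sumTo-cong m (λ k k≤ → cong (λ t → ∣ t - q * n ∣) (sumTo-cong k (λ j j≤ →
  trans (at-tabulateℕ (suc (suc m)) (closeUp n m (r ◂ b)) j (s≤s (m≤n⇒m≤1+n (≤-trans j≤ k≤)))) (closeUp-≤ n m (r ◂ b) j (≤-trans j≤ k≤)))))

witness-staircase : ∀ m r b → (∀ k → 1 ≤ k → k ≤ m → b k ≤ 1) → Staircase m (sumTo (r ◂ b))
witness-staircase m r b bits = Staircase-sumTo m (r ◂ b) (λ { (suc k) _ k≤m → bits (suc k) (s≤s z≤n) k≤m })

allOnesBut : ℕ → ℕ → ℕ
allOnesBut p k = 1 ∸ χ≡ k p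

ramp-below : ∀ r p k → k < p → sumTo (r ◂ allOnesBut p) k ≡ r + k
ramp-below r p zero _ = sym (+-identityʳ r)
ramp-below r p (suc k) sk<p = begin
  sumTo (r ◂ allOnesBut p) k + (1 ∸ χ≡ (suc k) p) ≡⟨ cong₂ _+_ (ramp-below r p k (<-trans (n<1+n k) sk<p)) (cong (1 ∸_) (χ≡-no (<⇒≢ sk<p))) ⟩
  r + k + 1                                        ≡⟨ trans (+-assoc r k 1) (cong (r +_) (+-comm k 1)) ⟩
  r + suc k                                        ∎
  where open ≡-Reasoning

ramp-above : ∀ r p k → 1 ≤ p → p ≤ k → suc (sumTo (r ◂ allOnesBut p) k) ≡ r + k
ramp-above r (suc p) zero 1≤p ()
ramp-above r p (suc k) 1≤p p≤sk with suc k ≟ p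
... | yes refl = begin
  suc (sumTo (r ◂ allOnesBut (suc k)) k + (1 ∸ χ≡ k k)) ≡⟨ cong₂ (λ s t → suc (s + (1 ∸ t))) (ramp-below r (suc k) k ≤-refl) (χ≡-refl k) ⟩
  suc (r + k + 0)                                        ≡⟨ cong suc (+-identityʳ _) ⟩
  suc (r + k)                                            ≡⟨ sym (+-suc r k) ⟩
  r + suc k                                              ∎
  where open ≡-Reasoning
... | no sk≢p = begin
  suc (sumTo (r ◂ allOnesBut p) k + (1 ∸ χ≡ (suc k) p)) ≡⟨ cong (λ t → suc (sumTo (r ◂ allOnesBut p) k + (1 ∸ t))) (χ≡-no sk≢p) ⟩
  suc (sumTo (r ◂ allOnesBut p) k + 1)                  ≡⟨ cong suc (+-comm _ 1) ⟩
  suc (suc (sumTo (r ◂ allOnesBut p) k))                ≡⟨ cong suc (ramp-above r p k 1≤p (≤-pred (≤∧≢⇒< p≤sk (λ e → sk≢p (sym e))))) ⟩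
  suc (r + k)                                           ≡⟨ sym (+-suc r k) ⟩
  r + suc k                                             ∎
  where open ≡-Reasoning

sumTo-∣k-j∣ : ∀ m j → j ≤ m → sumTo (λ k → ∣ k - j ∣) m ≡ tri j + tri (m ∸ j)
sumTo-∣k-j∣ m j j≤m with m≤n⇒∃[o]m+o≡n j≤m
... | d , refl = go d
  where
  upto : ∀ j → sumTo (λ k → ∣ k - j ∣) j ≡ tri j
  upto zero = refl
  upto (suc j) = trans (sumTo-unfoldˡ (λ k → ∣ k - suc j ∣) j) (trans (cong (suc j +_) (upto j)) (+-comm (suc j) (tri j)))
  go : ∀ d → sumTo (λ k → ∣ k - j ∣) (j + d) ≡ tri j + tri (j + d ∸ j)
  go zero rewrite +-identityʳ j | n∸n≡0 j = trans (upto j) (sym (+-identityʳ _))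
  go (suc d) rewrite +-suc j d = begin
    sumTo (λ k → ∣ k - j ∣) (j + d) + ∣ suc (j + d) - j ∣ ≡⟨ cong₂ _+_ (go d) (trans (cong (λ t → ∣ t - j ∣) (sym (+-suc j d))) (∣m+n-m∣≡n j (suc d))) ⟩
    tri j + tri (j + d ∸ j) + suc d                     ≡⟨ cong (λ t → tri j + tri t + suc d) (m+n∸m≡n j d) ⟩
    tri j + tri d + suc d                               ≡⟨ +-assoc (tri j) _ _ ⟩
    tri j + tri (suc d)                                 ≡⟨ cong (λ t → tri j + tri t) (sym (trans (cong (_∸ j) (sym (+-suc j d))) (m+n∸m≡n j (suc d)))) ⟩
    tri j + tri (suc (j + d) ∸ j)                       ∎
    where open ≡-Reasoning

#<-count : ∀ p m → p ≤ suc m → sumTo (λ k → χ< k p) m ≡ p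
#<-count zero zero _ = refl
#<-count (suc zero) zero _ = refl
#<-count (suc (suc p)) zero (s≤s ())
#<-count p (suc m) p≤ with p ≟ suc (suc m)
... | yes refl = trans (cong (_+ χ< (suc m) (suc (suc m))) all)
    (trans (cong (suc m +_) (χ<-yes (n<1+n (suc m)))) (+-comm (suc m) 1))
  where
  all : sumTo (λ k → χ< k (suc (suc m))) m ≡ suc m
  all = trans (sumTo-cong m (λ k k≤ → χ<-yes (s≤s (m≤n⇒m≤1+n k≤)))) (trans (sumTo-const 1 m) (*-identityʳ (suc m)))
... | no p≢ = trans (cong₂ _+_ (#<-count p m p≤sm) (χ<-no {suc m} {p} p≤sm)) (+-identityʳ p)
  where
  p≤sm : p ≤ suc m
  p≤sm = ≤-pred (≤∧≢⇒< p≤ p≢)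

#≮-count : ∀ p m → p ≤ suc m → sumTo (λ k → 1 ∸ χ< k p) m ≡ suc m ∸ p
#≮-count p m p≤ = trans (sym (m+n∸m≡n (sumTo (λ k → χ< k p) m) _))
  (cong₂ _∸_ (sumTo-bits+complement (λ k → χ< k p) m (λ k _ → χ<-≤1 k p)) (#<-count p m p≤))

-- Relative to a point of the ramp, the ramp looks like 0, 1, …, m shifted by j,
-- except that the points on the far side of the missing step p are one closer.
spread-ramp-before-gap : ∀ m r p j → j < p → j ≤ m →
  spread m (sumTo (r ◂ allOnesBut p)) (sumTo (r ◂ allOnesBut p) j) + sumTo (λ k → 1 ∸ χ< k p) m ≡ tri j + tri (m ∸ j)
spread-ramp-before-gap m r p j j<p j≤m = trans (sym (sumTo-+ _ _ m)) (trans (sumTo-cong m pointwise) (sumTo-∣k-j∣ m j j≤m))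
  where
  X = sumTo (r ◂ allOnesBut p)
  pointwise : ∀ k → k ≤ m → ∣ X k - X j ∣ + (1 ∸ χ< k p) ≡ ∣ k - j ∣
  pointwise k k≤ with k <? p
  ... | yes k<p rewrite χ<-yes k<p | ramp-below r p k k<p | ramp-below r p j j<p = trans (+-identityʳ _) (∣m+n-m+o∣≡∣n-o∣ r k j)
  ... | no k≮p rewrite χ<-no {k} {p} (≮⇒≥ k≮p) | ramp-below r p j j<p = begin
      ∣ X k - r + j ∣ + 1   ≡⟨ ∣m-n∣+1≡∣1+m-n∣ rj≤Xk ⟩
      ∣ suc (X k) - r + j ∣ ≡⟨ cong (λ t → ∣ t - r + j ∣) (ramp-above r p k 1≤p (≮⇒≥ k≮p)) ⟩
      ∣ r + k - r + j ∣     ≡⟨ ∣m+n-m+o∣≡∣n-o∣ r k j ⟩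
      ∣ k - j ∣             ∎
    where
    open ≡-Reasoning
    1≤p : 1 ≤ p
    1≤p = ≤-trans (s≤s z≤n) j<p
    rj≤Xk : r + j ≤ X k
    rj≤Xk = ≤-pred (subst (suc (r + j) ≤_) (sym (ramp-above r p k 1≤p (≮⇒≥ k≮p)))
      (subst (_≤ r + k) (+-suc r j) (+-monoʳ-≤ r (<-≤-trans j<p (≮⇒≥ k≮p)))))

spread-ramp-after-gap : ∀ m r p j → 1 ≤ p → p ≤ j → j ≤ m →
  spread m (sumTo (r ◂ allOnesBut p)) (sumTo (r ◂ allOnesBut p) j) + sumTo (λ k → χ< k p) m ≡ tri j + tri (m ∸ j)
spread-ramp-after-gap m r p j 1≤p p≤j j≤m = trans (sym (sumTo-+ _ _ m)) (trans (sumTo-cong m pointwise) (sumTo-∣k-j∣ m j j≤m))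
  where
  X = sumTo (r ◂ allOnesBut p)
  Xj : suc (X j) ≡ r + j
  Xj = ramp-above r p j 1≤p p≤j
  pointwise : ∀ k → k ≤ m → ∣ X k - X j ∣ + χ< k p ≡ ∣ k - j ∣
  pointwise k k≤ with k <? p
  ... | yes k<p rewrite χ<-yes k<p = begin
      ∣ X k - X j ∣ + 1     ≡⟨ cong (_+ 1) (∣-∣-comm (X k) (X j)) ⟩
      ∣ X j - X k ∣ + 1     ≡⟨ ∣m-n∣+1≡∣1+m-n∣ Xk≤Xj ⟩
      ∣ suc (X j) - X k ∣   ≡⟨ cong₂ ∣_-_∣ Xj (ramp-below r p k k<p) ⟩
      ∣ r + j - r + k ∣     ≡⟨ ∣m+n-m+o∣≡∣n-o∣ r j k ⟩
      ∣ j - k ∣             ≡⟨ ∣-∣-comm j k ⟩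
      ∣ k - j ∣             ∎
    where
    open ≡-Reasoning
    Xk≤Xj : X k ≤ X j
    Xk≤Xj = ≤-pred (subst (suc (X k) ≤_) (sym Xj) (subst (λ t → suc t ≤ r + j) (sym (ramp-below r p k k<p))
      (subst (_≤ r + j) (+-suc r k) (+-monoʳ-≤ r (<-≤-trans k<p p≤j)))))
  ... | no k≮p rewrite χ<-no {k} {p} (≮⇒≥ k≮p) = begin
      ∣ X k - X j ∣ + 0             ≡⟨ +-identityʳ _ ⟩
      ∣ suc (X k) - suc (X j) ∣     ≡⟨ cong₂ ∣_-_∣ (ramp-above r p k 1≤p (≮⇒≥ k≮p)) Xj ⟩
      ∣ r + k - r + j ∣             ≡⟨ ∣m+n-m+o∣≡∣n-o∣ r k j ⟩
      ∣ k - j ∣                     ∎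
    where open ≡-Reasoning

-- The ramp r, r + 1, …, r + m through the multiples of n at A and A + n.
far-ramp : ∀ n m A E → 1 ≤ n → A + n ≤ m → 2 * A ≤ suc m → 2 * (m ∸ (A + n)) ≤ suc m →
  E ≤ tri A + tri (m ∸ A) → E ≤ tri (A + n) + tri (m ∸ (A + n)) → FarVertex n m E
far-ramp n m A E 1≤n A+n≤m low high E≤₁ E≤₂ with toMultiple-∣ n A 1≤n
... | divides q₁ A+r≡ = witness n m r b , witness-valid n m r b 1≤n (toMultiple-< n A 1≤n) (λ k _ _ → m∸n≤m 1 (χ≡ k p)) , far
  where
  r = toMultiple n A
  p = suc m
  b = allOnesBut p
  X = sumTo (r ◂ b)
  A≤m : A ≤ m
  A≤m = ≤-trans (m≤m+n A n) A+n≤m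
  spread-at : ∀ j → j ≤ m → spread m X (X j) ≡ tri j + tri (m ∸ j)
  spread-at j j≤m = trans (sym (trans (cong (spread m X (X j) +_) (trans (#≮-count p m ≤-refl) (n∸n≡0 (suc m)))) (+-identityʳ _)))
    (spread-ramp-before-gap m r p j (s≤s j≤m) j≤m)
  X₁≡ : X A ≡ q₁ * n
  X₁≡ = trans (ramp-below r p A (s≤s A≤m)) (trans (+-comm r A) A+r≡)
  X₂≡ : X (A + n) ≡ suc q₁ * n
  X₂≡ = trans (ramp-below r p (A + n) (s≤s A+n≤m))
    (trans (sym (+-assoc r A n)) (trans (cong (_+ n) (trans (+-comm r A) A+r≡)) (+-comm (q₁ * n) n)))
  far : ∀ q → E ≤ cost n m (at (witness n m r b)) q
  far q = subst (E ≤_) (sym (witness-cost n m r b q))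
    (spread-at-multiples-≥ n m X E (witness-staircase m r b (λ k _ _ → m∸n≤m 1 (χ≡ k p))) A (A + n) q₁ A+n≤m low high X₁≡ X₂≡
      (subst (E ≤_) (sym (spread-at A A≤m)) E≤₁) (subst (E ≤_) (sym (spread-at (A + n) A+n≤m)) E≤₂) q)

-- The ramp with one missing step at p, through the multiples of n at a and a + n + 1.
far-ramp-with-gap : ∀ n m a p E → 1 ≤ n → 1 ≤ p → a < p → p ≤ a + suc n → a + suc n ≤ m →
  2 * a ≤ suc m → 2 * (m ∸ (a + suc n)) ≤ suc m →
  E + (suc m ∸ p) ≤ tri a + tri (m ∸ a) → E + p ≤ tri (a + suc n) + tri (m ∸ (a + suc n)) → FarVertex n m E
far-ramp-with-gap n m a p E 1≤n 1≤p a<p p≤j₂ j₂≤m low high E≤₁ E≤₂ with toMultiple-∣ n a 1≤n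
... | divides q₁ a+r≡ = witness n m r b , witness-valid n m r b 1≤n (toMultiple-< n a 1≤n) (λ k _ _ → m∸n≤m 1 (χ≡ k p)) , far
  where
  r = toMultiple n a
  b = allOnesBut p
  X = sumTo (r ◂ b)
  j₂ = a + suc n
  p≤sm : p ≤ suc m
  p≤sm = ≤-trans p≤j₂ (m≤n⇒m≤1+n j₂≤m)
  a≤m : a ≤ m
  a≤m = ≤-trans (m≤m+n a (suc n)) j₂≤m
  X₁≡ : X a ≡ q₁ * n
  X₁≡ = trans (ramp-below r p a a<p) (trans (+-comm r a) a+r≡)
  X₂≡ : X j₂ ≡ suc q₁ * n
  X₂≡ = suc-injective (trans (ramp-above r p j₂ 1≤p p≤j₂) (trans (rearrange r a n)
    (cong suc (trans (cong (_+ n) (trans (+-comm r a) a+r≡)) (+-comm (q₁ * n) n)))))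
    where
    rearrange : ∀ r a n → r + (a + suc n) ≡ suc (r + a + n)
    rearrange = solve-∀
  E≤X₁ : E ≤ spread m X (X a)
  E≤X₁ = +-cancelʳ-≤ (suc m ∸ p) E _ (subst (E + (suc m ∸ p) ≤_)
    (sym (trans (cong (spread m X (X a) +_) (sym (#≮-count p m p≤sm))) (spread-ramp-before-gap m r p a a<p a≤m))) E≤₁)
  E≤X₂ : E ≤ spread m X (X j₂)
  E≤X₂ = +-cancelʳ-≤ p E _ (subst (E + p ≤_)
    (sym (trans (cong (spread m X (X j₂) +_) (sym (#<-count p m p≤sm))) (spread-ramp-after-gap m r p j₂ 1≤p p≤j₂ j₂≤m))) E≤₂)
  far : ∀ q → E ≤ cost n m (at (witness n m r b)) q
  far q = subst (E ≤_) (sym (witness-cost n m r b q))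
    (spread-at-multiples-≥ n m X E (witness-staircase m r b (λ k _ _ → m∸n≤m 1 (χ≡ k p))) a j₂ q₁ j₂≤m low high X₁≡ X₂≡ E≤X₁ E≤X₂ q)

-- For n = 2h: h units in the first bucket, none inside.
far-flat : ∀ m h → 1 ≤ h → FarVertex (h + h) m (suc m * h)
far-flat m h 1≤h = witness n m h b , witness-valid n m h b (≤-trans 1≤h (m≤m+n h h)) h<n (λ _ _ _ → z≤n) , far
  where
  n = h + h
  b : ℕ → ℕ
  b _ = 0
  h<n : h < n
  h<n = subst (_≤ h + h) (+-comm h 1) (+-monoʳ-≤ h 1≤h)
  flat : ∀ k → sumTo (h ◂ b) k ≡ h
  flat zero = refl
  flat (suc k) = trans (+-identityʳ _) (flat k)
  h≤∣h-qn∣ : ∀ q → h ≤ ∣ h - q * n ∣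
  h≤∣h-qn∣ zero = ≤-reflexive (sym (∣-∣-identityʳ h))
  h≤∣h-qn∣ (suc q) = subst (h ≤_) (sym (trans (∣-∣-comm h _) (trans (cong (λ t → ∣ t - h ∣) (+-assoc h h (q * n)))
    (∣m+n-m∣≡n h (h + q * n))))) (m≤m+n h _)
  far : ∀ q → suc m * h ≤ cost n m (at (witness n m h b)) q
  far q = subst (suc m * h ≤_) (sym (witness-cost n m h b q)) (subst (_≤ spread m (sumTo (h ◂ b)) (q * n)) (sumTo-const h m)
    (sumTo-mono-≤ m (λ k _ → subst (λ t → h ≤ ∣ t - q * n ∣) (sym (flat k)) (h≤∣h-qn∣ q))))

-- For n = 2h + 1: h units in the first bucket and one inside, halfway.
far-step : ∀ m h → FarVertex (suc (h + h)) m (⌊ suc m /2⌋ + suc m * h)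
far-step m h = witness n m h b , witness-valid n m h b (s≤s z≤n) (s≤s (m≤m+n h h)) (λ k _ _ → χ≡-≤1 k K) , far
  where
  n = suc (h + h)
  K = suc ⌊ m /2⌋
  b : ℕ → ℕ
  b k = χ≡ k K
  X = sumTo (h ◂ b)
  K≤sm : K ≤ suc m
  K≤sm = s≤s (⌊n/2⌋≤n m)
  unit-at-K : ∀ k → 1 ∸ χ< (suc k) K ≡ (1 ∸ χ< k K) + χ≡ (suc k) K
  unit-at-K k with suc k <? K | k <? K
  ... | yes sk<K | _ rewrite χ<-yes sk<K | χ<-yes (<-trans (n<1+n k) sk<K) | χ≡-no (<⇒≢ sk<K) = refl
  ... | no sk≮K | yes k<K rewrite χ<-no (≮⇒≥ sk≮K) | χ<-yes k<K =
    sym (trans (cong (χ≡ (suc k)) (sym (≤-antisym k<K (≮⇒≥ sk≮K)))) (χ≡-refl (suc k)))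
  ... | no sk≮K | no k≮K rewrite χ<-no (≮⇒≥ sk≮K) | χ<-no (≮⇒≥ k≮K) | χ≡-no (λ e → k≮K (subst (k <_) e ≤-refl)) = refl
  X≡ : ∀ k → X k ≡ h + (1 ∸ χ< k K)
  X≡ zero = sym (+-identityʳ h)
  X≡ (suc k) = trans (cong (_+ χ≡ (suc k) K) (X≡ k)) (trans (+-assoc h _ _) (cong (h +_) (sym (unit-at-K k))))
  spread-at-0 : spread m X 0 ≡ suc m * h + (suc m ∸ K)
  spread-at-0 = trans (sumTo-cong m (λ k _ → trans (∣-∣-identityʳ (X k)) (X≡ k)))
    (trans (sumTo-+ _ _ m) (cong₂ _+_ (sumTo-const h m) (#≮-count K m K≤sm)))
  ∣X-n∣ : ∀ l → l ≤ 1 → ∣ h + (1 ∸ l) - n ∣ ≡ h + l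
  ∣X-n∣ zero _ = trans (cong (λ t → ∣ t - n ∣) (+-comm h 1)) (trans (∣m-m+n∣≡n (suc h) h) (sym (+-identityʳ h)))
  ∣X-n∣ (suc zero) _ = trans (cong (λ t → ∣ t - n ∣) (+-identityʳ h))
    (trans (cong (λ t → ∣ h - t ∣) (sym (+-suc h h))) (trans (∣m-m+n∣≡n h (suc h)) (+-comm 1 h)))
  ∣X-n∣ (suc (suc l)) (s≤s ())
  spread-at-n : spread m X (1 * n) ≡ suc m * h + K
  spread-at-n = trans (sumTo-cong m (λ k _ → trans (cong₂ ∣_-_∣ (X≡ k) (+-identityʳ n)) (∣X-n∣ (χ< k K) (χ<-≤1 k K))))
    (trans (sumTo-+ _ _ m) (cong₂ _+_ (sumTo-const h m) (#<-count K m K≤sm)))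
  X≤n : ∀ k → k ≤ m → X k ≤ 1 * n
  X≤n k _ = subst₂ _≤_ (sym (X≡ k)) (sym (+-identityʳ n)) (≤-trans (+-monoʳ-≤ h (m∸n≤m 1 (χ< k K))) (≤-trans (≤-reflexive (+-comm h 1)) (s≤s (m≤m+n h h))))
  far : ∀ q → ⌊ suc m /2⌋ + suc m * h ≤ cost n m (at (witness n m h b)) q
  far q rewrite witness-cost n m h b q with q
  ... | zero = subst₂ _≤_ (+-comm (suc m * h) _) (sym spread-at-0)
    (+-monoʳ-≤ (suc m * h) (≤-reflexive (sym (trans (cong (_∸ ⌊ m /2⌋) (sym (⌊n/2⌋+⌈n/2⌉≡n m))) (m+n∸m≡n ⌊ m /2⌋ ⌈ m /2⌉)))))
  ... | suc q′ = ≤-trans (subst₂ _≤_ (+-comm (suc m * h) _) (sym spread-at-n) (+-monoʳ-≤ (suc m * h) (⌊n/2⌋-mono (n≤1+n (suc m)))))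
    (spread-raising-≥ m X (1 * n) (suc q′ * n) (*-monoˡ-≤ n (s≤s (z≤n {q′})))
      (≤-trans (≤-reflexive (#above-none m X _ X≤n)) z≤n))

-- The three regimes

every-vertex-within : ∀ n m A E → 1 ≤ n → A ≤ m ∸ A → tri A + tri (m ∸ A) ≤ E →
  ⌊ suc m * n /2⌋ + 2 * tri (A ∸ 1) ≤ E → ∀ y → Valid n m y → Σ ℕ λ q → cost n m (at y) q ≤ E
every-vertex-within n m A E 1≤n A≤m∸A central pair-budget y valid =
  spread-≤-at-some-multiple n m (sumTo (at y)) A E 1≤n
    (Staircase-sumTo m (at y) (interior≤1 V)) (first<n V) A≤m∸A (tri-pair-≤ m A E central) pair-budget
  where
  V = Valid⇒ValidSeq n m y valid

data Parity : ℕ → Set where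
  even : ∀ a → Parity (a + a)
  odd : ∀ a → Parity (suc (a + a))

parity : ∀ n → Parity n
parity zero = even 0
parity (suc n) with parity n
... | even a = odd a
... | odd a = subst Parity (cong suc (+-suc a a)) (even (suc a))

⌊1+a+a/2⌋≡a : ∀ a → ⌊ suc (a + a) /2⌋ ≡ a
⌊1+a+a/2⌋≡a a = sym (n≡⌈n+n/2⌉ a)

⌈1+a+a/2⌉≡1+a : ∀ a → ⌈ suc (a + a) /2⌉ ≡ suc a
⌈1+a+a/2⌉≡1+a a = cong suc (sym (n≡⌊n+n/2⌋ a))

⌊o+[h+h]/2⌋≡h : ∀ o h → o ≤ 1 → ⌊ o + (h + h) /2⌋ ≡ h
⌊o+[h+h]/2⌋≡h zero h _ = sym (n≡⌊n+n/2⌋ h)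
⌊o+[h+h]/2⌋≡h (suc zero) h _ = ⌊1+a+a/2⌋≡a h
⌊o+[h+h]/2⌋≡h (suc (suc o)) h (s≤s ())

⌈o+[h+h]/2⌉≡o+h : ∀ o h → o ≤ 1 → ⌈ o + (h + h) /2⌉ ≡ o + h
⌈o+[h+h]/2⌉≡o+h zero h _ = sym (n≡⌈n+n/2⌉ h)
⌈o+[h+h]/2⌉≡o+h (suc zero) h _ = ⌈1+a+a/2⌉≡1+a h
⌈o+[h+h]/2⌉≡o+h (suc (suc o)) h (s≤s ())

2*n≡n+n : ∀ a → 2 * a ≡ a + a
2*n≡n+n a = cong (a +_) (+-identityʳ a)

2∤1+a+a : ∀ a → ¬ (2 ∣ suc (a + a))
2∤1+a+a a (divides q e) = <-irrefl refl (subst₂ _<_ (trans (cong ⌊_/2⌋ e′) (sym (n≡⌊n+n/2⌋ q))) (trans (cong ⌈_/2⌉ e′) (sym (n≡⌈n+n/2⌉ q)))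
  (subst₂ _<_ (sym (⌊1+a+a/2⌋≡a a)) (sym (⌈1+a+a/2⌉≡1+a a)) (n<1+n a)))
  where
  e′ : suc (a + a) ≡ q + q
  e′ = trans e (trans (*-comm q 2) (2*n≡n+n q))

⌊[n+2a+1]n/2⌋ : ∀ n a → ⌊ suc (n + (a + a)) * n /2⌋ ≡ tri n + n * a
⌊[n+2a+1]n/2⌋ n a = trans (cong ⌊_/2⌋ doubled) (sym (n≡⌊n+n/2⌋ (tri n + n * a)))
  where
  expand : ∀ n a → suc (n + (a + a)) * n ≡ n * suc n + (n * a + n * a)
  expand = solve-∀
  doubled : suc (n + (a + a)) * n ≡ (tri n + n * a) + (tri n + n * a)
  doubled = trans (expand n a) (trans (cong (_+ (n * a + n * a)) (sym (tri+tri n))) (interchange (tri n) (tri n) (n * a) (n * a)))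

⌊[n+2a+2]n/2⌋ : ∀ n a h o → o ≤ 1 → n ≡ o + (h + h) → ⌊ suc (n + suc (a + a)) * n /2⌋ ≡ tri n + n * a + h
⌊[n+2a+2]n/2⌋ n a h o o≤1 n≡ = trans (cong ⌊_/2⌋ doubled) (⌊o+[h+h]/2⌋≡h o (tri n + n * a + h) o≤1)
  where
  expand : ∀ n a → suc (n + suc (a + a)) * n ≡ n * suc n + (n * a + n * a) + n
  expand = solve-∀
  rearrange : ∀ t na h o → t + t + (na + na) + (o + (h + h)) ≡ o + ((t + na + h) + (t + na + h))
  rearrange = solve-∀
  doubled : suc (n + suc (a + a)) * n ≡ o + ((tri n + n * a + h) + (tri n + n * a + h))
  doubled = trans (expand n a) (trans (cong₂ (λ u v → u + (n * a + n * a) + v) (sym (tri+tri n)) n≡) (rearrange (tri n) (n * a) h o))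

d₀-even : ∀ n a → d₀ n (n + (a + a)) ≡ tri (n + a) + tri a
d₀-even n a = cong₂ _+_
  (trans (T≡tri ⌊ n + (a + a) + n /2⌋) (cong tri (trans (cong ⌊_/2⌋ (rearrange n a)) (sym (n≡⌊n+n/2⌋ (n + a))))))
  (trans (T≡tri ⌈ n + (a + a) ∸ n /2⌉) (cong tri (trans (cong ⌈_/2⌉ (m+n∸m≡n n (a + a))) (sym (n≡⌈n+n/2⌉ a)))))
  where
  rearrange : ∀ n a → n + (a + a) + n ≡ (n + a) + (n + a)
  rearrange = solve-∀

d₀-odd : ∀ n a → d₀ n (n + suc (a + a)) ≡ tri (n + a) + tri (suc a)
d₀-odd n a = cong₂ _+_
  (trans (T≡tri ⌊ n + suc (a + a) + n /2⌋) (cong tri (trans (cong ⌊_/2⌋ (rearrange n a)) (⌊1+a+a/2⌋≡a (n + a)))))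
  (trans (T≡tri ⌈ n + suc (a + a) ∸ n /2⌉) (cong tri (trans (cong ⌈_/2⌉ (m+n∸m≡n n (suc (a + a)))) (⌈1+a+a/2⌉≡1+a a))))
  where
  rearrange : ∀ n a → n + suc (a + a) + n ≡ suc ((n + a) + (n + a))
  rearrange = solve-∀

⌈[n+2a+2]/2⌉ : ∀ n a h o → o ≤ 1 → n ≡ o + (h + h) → ⌈ suc (n + suc (a + a)) /2⌉ ≡ o + suc (h + a)
⌈[n+2a+2]/2⌉ n a h o o≤1 n≡ = trans (cong ⌈_/2⌉ (trans (cong (λ t → suc (t + suc (a + a))) n≡) (rearrange o h a)))
  (⌈o+[h+h]/2⌉≡o+h o (suc (h + a)) o≤1)
  where
  rearrange : ∀ o h a → suc (o + (h + h) + suc (a + a)) ≡ o + (suc (h + a) + suc (h + a))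
  rearrange = solve-∀

ecc-few-interior : ∀ n m → 1 ≤ n → m ≤ n → IsEcc n m (𝟎 m) ⌊ suc m * n /2⌋
ecc-few-interior n m 1≤n m≤n = ecc-from-cost n m E 1≤n
  (every-vertex-within n m 0 E 1≤n z≤n (2*m≤n⇒m≤⌊n/2⌋ 2tri≤) (≤-reflexive (+-identityʳ E))) (far (parity n) 1≤n)
  where
  E = ⌊ suc m * n /2⌋
  2tri≤ : 2 * tri m ≤ suc m * n
  2tri≤ = subst₂ _≤_ (sym (trans (2*n≡n+n (tri m)) (tri+tri m))) (*-comm n (suc m)) (*-monoˡ-≤ (suc m) m≤n)
  far : ∀ {k} → Parity k → 1 ≤ k → FarVertex k m ⌊ suc m * k /2⌋
  far (even h) 1≤k = subst (FarVertex (h + h) m) (sym (trans (cong ⌊_/2⌋ (*-distribˡ-+ (suc m) h h)) (sym (n≡⌊n+n/2⌋ (suc m * h)))))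
    (far-flat m h (n≢0⇒n>0 (λ h≡0 → <-irrefl refl (subst (λ t → 1 ≤ t + t) h≡0 1≤k))))
  far (odd h) _ = subst (FarVertex (suc (h + h)) m) (sym (trans (cong ⌊_/2⌋ (expand m h)) (⌊m+[n+n]/2⌋≡⌊m/2⌋+n (suc m) (suc m * h))))
    (far-step m h)
    where
    expand : ∀ m h → suc m * suc (h + h) ≡ suc m + (suc m * h + suc m * h)
    expand = solve-∀

ecc-even-excess : ∀ n a → 1 ≤ n → IsEcc n (n + (a + a)) (𝟎 (n + (a + a))) (tri (n + a) + tri a)
ecc-even-excess n a 1≤n = ecc-from-cost n m E 1≤n
  (every-vertex-within n m a E 1≤n (subst (a ≤_) (sym m∸a≡) (m≤n+m a n)) central budget)
  (far-ramp n m a E 1≤n a+n≤m 2a≤ (subst (λ t → 2 * t ≤ suc m) (sym m∸[a+n]≡) 2a≤) (≤-reflexive (sym central≡))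
    (≤-reflexive (trans (cong (_+ tri a) (cong tri (+-comm n a))) (cong (λ t → tri (a + n) + tri t) (sym m∸[a+n]≡)))))
  where
  m = n + (a + a)
  E = tri (n + a) + tri a
  m∸a≡ : m ∸ a ≡ n + a
  m∸a≡ = trans (cong (_∸ a) (sym (+-assoc n a a))) (m+n∸n≡m (n + a) a)
  m∸[a+n]≡ : m ∸ (a + n) ≡ a
  m∸[a+n]≡ = trans (cong (_∸ (a + n)) (rearrange n a)) (m+n∸m≡n (a + n) a)
    where
    rearrange : ∀ n a → n + (a + a) ≡ a + n + a
    rearrange = solve-∀
  central≡ : tri a + tri (m ∸ a) ≡ E
  central≡ = trans (cong (λ t → tri a + tri t) m∸a≡) (+-comm (tri a) _)
  central : tri a + tri (m ∸ a) ≤ E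
  central = ≤-reflexive central≡
  budget : ⌊ suc m * n /2⌋ + 2 * tri (a ∸ 1) ≤ E
  budget = begin
    ⌊ suc m * n /2⌋ + 2 * tri (a ∸ 1)   ≡⟨ cong (_+ 2 * tri (a ∸ 1)) (⌊[n+2a+1]n/2⌋ n a) ⟩
    tri n + n * a + 2 * tri (a ∸ 1)     ≤⟨ +-monoʳ-≤ (tri n + n * a) (*-monoʳ-≤ 2 (tri-mono-≤ (m∸n≤m a 1))) ⟩
    tri n + n * a + 2 * tri a           ≡⟨ rearrange (tri n) (n * a) (tri a) ⟩
    tri n + tri a + n * a + tri a       ≡⟨ cong (_+ tri a) (sym (tri-+ n a)) ⟩
    E                                   ∎
    where
    open ≤-Reasoning
    rearrange : ∀ tn na ta → tn + na + 2 * ta ≡ tn + ta + na + ta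
    rearrange = solve-∀
  a+n≤m : a + n ≤ m
  a+n≤m = subst (_≤ m) (+-comm n a) (+-monoʳ-≤ n (m≤m+n a a))
  2a≤ : 2 * a ≤ suc m
  2a≤ = ≤-trans (≤-reflexive (2*n≡n+n a)) (≤-trans (m≤n+m (a + a) n) (n≤1+n _))

module OddExcess (n a : ℕ) (1≤n : 1 ≤ n) where

  m E₀ : ℕ
  m = n + suc (a + a)
  E₀ = tri (n + a) + tri (suc a)

  m∸[1+a]≡ : m ∸ suc a ≡ n + a
  m∸[1+a]≡ = trans (cong (_∸ suc a) (rearrange n a)) (m+n∸n≡m (n + a) (suc a))
    where
    rearrange : ∀ n a → n + suc (a + a) ≡ n + a + suc a
    rearrange = solve-∀

  m∸[a+1+n]≡a : m ∸ (a + suc n) ≡ a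
  m∸[a+1+n]≡a = trans (cong (_∸ (a + suc n)) (rearrange n a)) (m+n∸m≡n (a + suc n) a)
    where
    rearrange : ∀ n a → n + suc (a + a) ≡ a + suc n + a
    rearrange = solve-∀

  a+1+n≤m : a + suc n ≤ m
  a+1+n≤m = subst (_≤ m) (sym (+-suc a n)) (subst (suc (a + n) ≤_) (rearrange n a) (m≤m+n (suc (a + n)) a))
    where
    rearrange : ∀ n a → suc (a + n) + a ≡ n + suc (a + a)
    rearrange = solve-∀

  2a≤ : 2 * a ≤ suc m
  2a≤ = ≤-trans (≤-reflexive (2*n≡n+n a)) (≤-trans (n≤1+n _) (≤-trans (m≤n+m (suc (a + a)) n) (n≤1+n _)))

  E₀-expanded : E₀ ≡ (tri n + tri a + n * a) + (tri a + suc a)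
  E₀-expanded = cong (_+ tri (suc a)) (tri-+ n a)

  within : ∀ E → E₀ ≤ E → ⌊ suc m * n /2⌋ + 2 * tri a ≤ E → ∀ y → Valid n m y → Σ ℕ λ q → cost n m (at y) q ≤ E
  within E E₀≤E budget = every-vertex-within n m (suc a) E 1≤n
    (subst (suc a ≤_) (sym m∸[1+a]≡) (+-monoˡ-≤ a 1≤n))
    (≤-trans (≤-reflexive (trans (cong (λ t → tri (suc a) + tri t) m∸[1+a]≡) (+-comm (tri (suc a)) _))) E₀≤E) budget

ecc-odd-excess-small : ∀ n a h o → 1 ≤ n → o ≤ 1 → n ≡ o + (h + h) → h ≤ suc a →
  IsEcc n (n + suc (a + a)) (𝟎 (n + suc (a + a))) (tri (n + a) + tri (suc a))
ecc-odd-excess-small n a h o 1≤n o≤1 n≡ h≤1+a = ecc-from-cost n m E₀ 1≤n (within E₀ ≤-refl budget)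
  (far-ramp n m (suc a) E₀ 1≤n 1+a+n≤m (subst (_≤ suc m) (sym (2*n≡n+n (suc a))) (s≤s (≤-trans (≤-reflexive (+-suc a a)) (m≤n+m _ n))))
    (subst (λ t → 2 * t ≤ suc m) (sym m∸[1+a+n]≡a) 2a≤)
    (≤-reflexive (trans (+-comm (tri (n + a)) _) (cong (λ t → tri (suc a) + tri t) (sym m∸[1+a]≡))))
    (subst (E₀ ≤_) (cong (λ t → tri (suc a + n) + tri t) (sym m∸[1+a+n]≡a)) outward))
  where
  open OddExcess n a 1≤n
  1+a+n≤m : suc a + n ≤ m
  1+a+n≤m = subst (suc a + n ≤_) (rearrange n a) (m≤m+n (suc a + n) a)
    where
    rearrange : ∀ n a → suc a + n + a ≡ n + suc (a + a)
    rearrange = solve-∀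
  m∸[1+a+n]≡a : m ∸ (suc a + n) ≡ a
  m∸[1+a+n]≡a = trans (cong (m ∸_) (trans (cong suc (+-comm a n)) (sym (+-suc n a)))) (trans (cong (_∸ (n + suc a)) (sym (+-assoc n (suc a) a))) (m+n∸m≡n (n + suc a) a))
  budget : ⌊ suc m * n /2⌋ + 2 * tri a ≤ E₀
  budget = subst₂ _≤_ (sym (cong (_+ 2 * tri a) (⌊[n+2a+2]n/2⌋ n a h o o≤1 n≡))) (sym E₀-expanded)
    (subst (tri n + n * a + h + 2 * tri a ≤_) (rearrange (tri n) (tri a) (n * a) a)
      (+-monoˡ-≤ (2 * tri a) (+-monoʳ-≤ (tri n + n * a) h≤1+a)))
    where
    rearrange : ∀ tn ta na a → tn + na + suc a + 2 * ta ≡ (tn + ta + na) + (ta + suc a)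
    rearrange = solve-∀
  outward : E₀ ≤ tri (suc a + n) + tri a
  outward = subst₂ _≤_ (+-comm (tri (suc a)) (tri (n + a))) (trans (+-comm (tri a) _) (cong (λ t → tri (suc t) + tri a) (+-comm n a)))
    (tri-spread-≤ a (n + a) (m≤n+m a n))

-- Here n exceeds ⌈(m + 1)/2⌉ by e; the far vertex is a ramp whose missing step p sits
-- between the two multiples of n.
module LargeOddExcess (o a e : ℕ) where

  h n : ℕ
  h = suc a + e
  n = o + (h + h)

  1≤n : 1 ≤ n
  1≤n = ≤-trans (s≤s z≤n) (m≤n+m (h + h) o)

  open OddExcess n a 1≤n public

  E p : ℕ
  E = E₀ + e
  p = o + suc (h + a)

  1≤p : 1 ≤ p
  1≤p = ≤-trans (s≤s z≤n) (m≤n+m _ o)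

  a<p : a < p
  a<p = ≤-trans (s≤s (m≤n+m a h)) (m≤n+m _ o)

  p≤a+1+n : p ≤ a + suc n
  p≤a+1+n = subst (p ≤_) (rearrange o a e) (m≤m+n p h)
    where
    rearrange : ∀ o a e → o + suc ((suc a + e) + a) + (suc a + e) ≡ a + suc (o + ((suc a + e) + (suc a + e)))
    rearrange = solve-∀

  budget : o ≤ 1 → ⌊ suc m * n /2⌋ + 2 * tri a ≤ E
  budget o≤1 = ≤-reflexive (trans (cong (_+ 2 * tri a) (⌊[n+2a+2]n/2⌋ n a h o o≤1 refl))
    (trans (rearrange (tri n) (tri a) (n * a) a e) (sym (cong (_+ e) E₀-expanded))))
    where
    rearrange : ∀ tn ta na a e → tn + na + (suc a + e) + 2 * ta ≡ (tn + ta + na) + (ta + suc a) + e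
    rearrange = solve-∀

  before-gap : E + (suc m ∸ p) ≤ tri a + tri (m ∸ a)
  before-gap = subst₂ _≤_ (cong (E +_) (sym 1+m∸p≡)) (cong (λ t → tri a + tri t) (sym m∸a≡))
    (subst (E + (h + suc a) ≤_) (cong (tri a +_) (sym (cong tri (+-suc n a))))
      (subst (E + (h + suc a) ≤_) (rearrange (tri (n + a)) (tri a) o a e) (m≤m+n _ o)))
    where
    1+m∸p≡ : suc m ∸ p ≡ h + suc a
    1+m∸p≡ = trans (cong (_∸ p) (split o a e)) (m+n∸m≡n p (h + suc a))
      where
      split : ∀ o a e → suc (o + ((suc a + e) + (suc a + e)) + suc (a + a)) ≡ o + suc ((suc a + e) + a) + ((suc a + e) + suc a)
      split = solve-∀
    m∸a≡ : m ∸ a ≡ n + suc a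
    m∸a≡ = trans (cong (_∸ a) (split n a)) (m+n∸m≡n a (n + suc a))
      where
      split : ∀ n a → n + suc (a + a) ≡ a + (n + suc a)
      split = solve-∀
    rearrange : ∀ T ta o a e → T + (ta + suc a) + e + ((suc a + e) + suc a) + o ≡ ta + (T + suc (o + ((suc a + e) + (suc a + e)) + a))
    rearrange = solve-∀

  after-gap : E + p ≤ tri (a + suc n) + tri (m ∸ (a + suc n))
  after-gap = ≤-reflexive (trans (rearrange (tri (n + a)) (tri a) o a e)
    (sym (cong₂ _+_ (trans (cong tri (+-suc a n)) (cong (λ t → tri t + suc (a + n)) (+-comm a n))) (cong tri m∸[a+1+n]≡a))))
    where
    rearrange : ∀ T ta o a e → T + (ta + suc a) + e + (o + suc ((suc a + e) + a)) ≡ T + suc (a + (o + ((suc a + e) + (suc a + e)))) + ta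
    rearrange = solve-∀

ecc-odd-excess-large : ∀ o a e → o ≤ 1 → let n = o + ((suc a + e) + (suc a + e)) ; m = n + suc (a + a) in
  IsEcc n m (𝟎 m) (tri (n + a) + tri (suc a) + e)
ecc-odd-excess-large o a e o≤1 = ecc-from-cost n m E 1≤n (within E (m≤m+n E₀ e) (budget o≤1))
  (far-ramp-with-gap n m a p E 1≤n 1≤p a<p p≤a+1+n a+1+n≤m 2a≤ (subst (λ t → 2 * t ≤ suc m) (sym m∸[a+1+n]≡a) 2a≤)
    before-gap after-gap)
  where open LargeOddExcess o a e

ExcessCases : ℕ → ℕ → Set
ExcessCases n m =
  (((2 ∣ (m ∸ n)) ⊎ (n ≤ ⌈ suc m /2⌉)) → IsEcc n m (𝟎 m) (d₀ n m)) ×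
  (¬ ((2 ∣ (m ∸ n)) ⊎ (n ≤ ⌈ suc m /2⌉)) → IsEcc n m (𝟎 m) (d₀ n m + (n ∸ ⌈ suc m /2⌉)))

ecc-excess-even : ∀ n a → 1 ≤ n → ExcessCases n (n + (a + a))
ecc-excess-even n a 1≤n = (λ _ → subst (IsEcc n m (𝟎 m)) (sym (d₀-even n a)) (ecc-even-excess n a 1≤n)) ,
  (λ excluded → ⊥-elim (excluded (inj₁ (divides a (trans (m+n∸m≡n n (a + a)) (sym (trans (*-comm a 2) (2*n≡n+n a))))))))
  where m = n + (a + a)

halves : ∀ n → Σ ℕ λ h → Σ ℕ λ o → o ≤ 1 × n ≡ o + (h + h)
halves n with parity n
... | even h = h , 0 , z≤n , refl
... | odd h = h , 1 , s≤s z≤n , refl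

ecc-excess-odd : ∀ n a → 1 ≤ n → ExcessCases n (n + suc (a + a))
ecc-excess-odd n a 1≤n with halves n
... | h , o , o≤1 , n≡ = small , large
  where
  m = n + suc (a + a)
  ⌈1+m/2⌉≡ : ⌈ suc m /2⌉ ≡ o + suc (h + a)
  ⌈1+m/2⌉≡ = ⌈[n+2a+2]/2⌉ n a h o o≤1 n≡
  small : ((2 ∣ (m ∸ n)) ⊎ (n ≤ ⌈ suc m /2⌉)) → IsEcc n m (𝟎 m) (d₀ n m)
  small (inj₁ 2∣) = ⊥-elim (2∤1+a+a a (subst (2 ∣_) (m+n∸m≡n n (suc (a + a))) 2∣))
  small (inj₂ n≤) = subst (IsEcc n m (𝟎 m)) (sym (d₀-odd n a)) (ecc-odd-excess-small n a h o 1≤n o≤1 n≡ h≤1+a)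
    where
    h≤1+a : h ≤ suc a
    h≤1+a = +-cancelˡ-≤ h h (suc a) (subst (h + h ≤_) (sym (+-suc h a))
      (+-cancelˡ-≤ o _ _ (subst₂ _≤_ n≡ ⌈1+m/2⌉≡ n≤)))
  large : ¬ ((2 ∣ (m ∸ n)) ⊎ (n ≤ ⌈ suc m /2⌉)) → IsEcc n m (𝟎 m) (d₀ n m + (n ∸ ⌈ suc m /2⌉))
  large excluded with m≤n⇒∃[o]m+o≡n 1+a≤h
    where
    1+a≤h : suc a ≤ h
    1+a≤h = <⇒≤ (+-cancelˡ-< h (suc a) h (subst (_< h + h) (sym (+-suc h a))
      (+-cancelˡ-< o (suc (h + a)) (h + h) (subst₂ _<_ ⌈1+m/2⌉≡ n≡ (≰⇒> (λ n≤ → excluded (inj₂ n≤)))))))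
  ... | e , refl = subst (λ n → IsEcc n (n + suc (a + a)) (𝟎 _) (d₀ n (n + suc (a + a)) + (n ∸ ⌈ suc (n + suc (a + a)) /2⌉)))
        (sym n≡) (subst (IsEcc n′ m′ (𝟎 m′)) (sym (cong₂ _+_ (d₀-odd n′ a) gap≡)) (ecc-odd-excess-large o a e o≤1))
    where
    n′ = o + ((suc a + e) + (suc a + e))
    m′ = n′ + suc (a + a)
    gap≡ : n′ ∸ ⌈ suc m′ /2⌉ ≡ e
    gap≡ = trans (cong (n′ ∸_) (⌈[n+2a+2]/2⌉ n′ a (suc a + e) o o≤1 refl))
      (trans (cong (_∸ (o + suc (suc a + e + a))) (split o a e)) (m+n∸m≡n (o + suc (suc a + e + a)) e))
      where
      split : ∀ o a e → o + ((suc a + e) + (suc a + e)) ≡ o + suc ((suc a + e) + a) + e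
      split = solve-∀

ecc-excess : ∀ n m → 1 ≤ n → n ≤ m → ExcessCases n m
ecc-excess n m 1≤n n≤m with m≤n⇒∃[o]m+o≡n n≤m
... | d , refl with parity d
...   | even a = ecc-excess-even n a 1≤n
...   | odd a = ecc-excess-odd n a 1≤n

ecc-one-bucket-value : ∀ m → IsEcc 1 m (𝟎 m) (T ⌈ m /2⌉ + T ⌊ m /2⌋)
ecc-one-bucket-value zero = ecc-few-interior 1 0 ≤-refl z≤n
ecc-one-bucket-value (suc m) = subst (IsEcc 1 (suc m) (𝟎 (suc m))) (cong (λ t → T ⌊ t /2⌋ + T ⌈ m /2⌉) (+-comm (suc m) 1))
  (proj₁ (ecc-excess 1 (suc m) ≤-refl (s≤s z≤n)) (inj₂ (s≤s z≤n)))

theorem4p1 : (n m : ℕ) → 1 ≤ n →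
    (n ≡ 1 → IsEcc n m (𝟎 m) (T ⌈ m /2⌉ + T ⌊ m /2⌋)) ×
    (m ≤ n → IsEcc n m (𝟎 m) ⌊ n * (m + 1) /2⌋) ×
    (2 ≤ n → n ≤ m →
      (((2 ∣ (m ∸ n)) ⊎ (n ≤ ⌈ suc m /2⌉)) → IsEcc n m (𝟎 m) (d₀ n m)) ×
      (¬ ((2 ∣ (m ∸ n)) ⊎ (n ≤ ⌈ suc m /2⌉)) →
        IsEcc n m (𝟎 m) (d₀ n m + (n ∸ ⌈ suc m /2⌉))))
theorem4p1 n m 1≤n =
  (λ { refl → ecc-one-bucket-value m }) ,
  (λ m≤n → subst (IsEcc n m (𝟎 m)) (cong ⌊_/2⌋ (trans (*-comm (suc m) n) (cong (n *_) (+-comm 1 m))))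
             (ecc-few-interior n m 1≤n m≤n)) ,
  -- the excess case holds already for n = 1
  (λ _ n≤m → ecc-excess n m 1≤n n≤m)
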